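{- Let $m,n,k$ be positive integers with $2k \le m+n$, and let $K_{m,n}$ be the complete bipartite graph. Then \[ cpr_{2k}(K_{m,n}) \;\geq\; \binom{m}{2}\binom{n}{2}-\frac{(k^{4}-k^{2})\,m^{2}n^{2}}{12k^{4}}, \] and equality holds whenever $k \mid m$ and $k \mid n$.
   Context: A graph $G$ is $p$-partite if its vertex set can be partitioned into $p$ nonempty independent sets (parts). For a $p$-partite graph $G$ with a chosen partition into parts and a chosen numbering $1,\dots,p$ of the parts, a circular $p$-partite drawing of $G$ is obtained as follows: partition a circle into $p$ consecutive segments of arc; place the vertices of the $i$-th part at distinct points of the $i$-th segment of arc; draw each edge as the straight chord of the circle joining its endpoints, with no more than two edges meeting at any crossing point. A crossing is a point interior to the disk where two chords cross. The circular $p$-partite crossing number $cpr_{p}(G)$ is the minimum number of crossings taken over all circular $p$-partite drawings of $G$, over all possible partitions of the vertices of $G$ into $p$ parts (independent sets), and over all numberings of the parts. -}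

module Defs where

open import Data.Nat using (ℕ; zero; suc; _+_; _*_; _<_; _⊓_; _⊔_)
open import Data.Nat.Properties using (_<?_)
open import Data.Fin using (Fin; toℕ)
open import Data.Sum using (_⊎_; inj₁; inj₂)
open import Data.Product using (_×_; Σ; ∃)
open import Relation.Nullary using (¬_; Dec; yes; no)
open import Relation.Nullary.Decidable using (_×-dec_)
open import Relation.Binary.PropositionalEquality using (_≡_)
open import Function.Definitions using (Injective)
open import Data.Fin using () renaming (_<_ to _<ꟳ_)

-- Vertices of the complete bipartite graph K_{m,n}:
-- inj₁ i (i : Fin m) on one side, inj₂ j (j : Fin n) on the other.
-- Its edges are exactly the pairs (inj₁ i , inj₂ j), indexed by Fin m × Fin n.
Vertex : ℕ → ℕ → Set
Vertex m n = Fin m ⊎ Fin n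

-- A circular p-partite drawing of K_{m,n} (up to the combinatorial data
-- that determines its crossings):
--  * part : a partition of the vertices into p parts numbered 0..p-1,
--    every part nonempty, every part an independent set;
--  * pos  : the (injective) position of each vertex in the circular order,
--    read starting from the beginning of segment 0; vertices of part i
--    lie in the i-th consecutive arc, i.e. pos is monotone in part.
record Drawing (m n p : ℕ) : Set where
  field
    part        : Vertex m n → Fin p
    nonempty    : (i : Fin p) → ∃ λ v → part v ≡ i
    independent : (i : Fin m) (j : Fin n) → ¬ (part (inj₁ i) ≡ part (inj₂ j))
    pos         : Vertex m n → Fin (m + n)
    pos-inj     : Injective _≡_ _≡_ pos
    segments    : (u v : Vertex m n) → part u <ꟳ part v → pos u <ꟳ pos v

open Drawing public

lo hi : {m n p : ℕ} → Drawing m n p → Fin m → Fin n → ℕ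
lo D i j = toℕ (pos D (inj₁ i)) ⊓ toℕ (pos D (inj₂ j))
hi D i j = toℕ (pos D (inj₁ i)) ⊔ toℕ (pos D (inj₂ j))

-- Two straight chords cross iff their endpoints interleave on the circle.
-- Ordered version: edge e "crosses-forward" f iff lo e < lo f < hi e < hi f;
-- every unordered crossing pair is counted exactly once this way.
Crosses : {m n p : ℕ} → Drawing m n p → Fin m → Fin n → Fin m → Fin n → Set
Crosses D i j i′ j′ = lo D i j < lo D i′ j′ × (lo D i′ j′ < hi D i j × hi D i j < hi D i′ j′)

crosses? : {m n p : ℕ} (D : Drawing m n p) (i : Fin m) (j : Fin n) (i′ : Fin m) (j′ : Fin n)
         → Dec (Crosses D i j i′ j′)
crosses? D i j i′ j′ =
  (lo D i j <? lo D i′ j′) ×-dec ((lo D i′ j′ <? hi D i j) ×-dec (hi D i j <? hi D i′ j′))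

indicator : {P : Set} → Dec P → ℕ
indicator (yes _) = 1
indicator (no _)  = 0

sumFin : (n : ℕ) → (Fin n → ℕ) → ℕ
sumFin zero    f = 0
sumFin (suc n) f = f Fin.zero + sumFin n (λ i → f (Fin.suc i))

crossings : {m n p : ℕ} → Drawing m n p → ℕ
crossings {m} {n} D =
  sumFin m λ i → sumFin n λ j → sumFin m λ i′ → sumFin n λ j′ →
    indicator (crosses? D i j i′ j′)

{-# OPTIONS --safe #-}
module Submission where

-- Cut the circle open at the start of part 0 and, for a first-class vertex a, let f a be the
-- number of second-class vertices placed before a.  Of the three ways to pair up two
-- first-class and two second-class vertices, exactly one gives crossing chords; summing over
-- all such quadruples yields
--   4 cr + 2 Z = m (m - 1) n (n - 1),  where  Z = Σ_{a,a′} d (n - d),  d = |f a - f a′|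
-- is the number of second-class vertices between a and a′.  So Z = n G - W with G and W the
-- sums of |f a - f a′| and of (f a - f a′)².  Since the 2k parts are consecutive arcs, f is
-- constant on each of the k pairs of neighbouring parts, and for a function with at most k
-- values Cauchy–Schwarz and the power-mean inequality give 3 k² G² ≤ 2 (k² - 1) m² W; with
-- AM-GM this is 6 k² Z ≤ (k² - 1) m² n².  When k divides m and n, alternating k blocks of
-- m/k first-class and n/k second-class vertices makes f take each value (n/k)·y, y < k,
-- exactly m/k times, and then 6 k² Z = (k² - 1) m² n².

open import Defs
open import Data.Nat using (ℕ)
import Data.Nat as ℕ
open import Data.Fin using (Fin)
open import Relation.Binary.PropositionalEquality using (_≡_)

module IntegerOrder where

  open import Data.Nat using (z≤n)
  open import Data.Integer using (+_; -[1+_]; _+_; _*_; -_; _-_; 0ℤ; _≤_; _<_; +≤+; nonNegative; positive)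
  open import Data.Integer.Properties
    using (≤-trans; ≤-reflexive; ≤-antisym; *-zeroʳ; *-comm; *-monoˡ-≤-nonNeg; *-cancelˡ-≤-pos;
           i*j≡0⇒i≡0∨j≡0; +-inverseʳ; 0≤i-j⇒j≤i)
  open import Data.Integer.Tactic.RingSolver using (solve-∀)
  open import Data.Sum using (inj₁; inj₂)
  open import Relation.Binary.PropositionalEquality using (_≡_; sym; trans; cong)

  *-monoˡ-≤-0≤ : ∀ {c a b} → 0ℤ ≤ c → a ≤ b → c * a ≤ c * b
  *-monoˡ-≤-0≤ {c} 0≤c = *-monoˡ-≤-nonNeg c {{nonNegative 0≤c}}

  *-cancelˡ-≤-0< : ∀ {c a b} → 0ℤ < c → c * a ≤ c * b → a ≤ b
  *-cancelˡ-≤-0< {c} {a} {b} 0<c = *-cancelˡ-≤-pos a b c {{positive 0<c}}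

  *-0≤ : ∀ {a b} → 0ℤ ≤ a → 0ℤ ≤ b → 0ℤ ≤ a * b
  *-0≤ {a} 0≤a 0≤b = ≤-trans (≤-reflexive (sym (*-zeroʳ a))) (*-monoˡ-≤-0≤ 0≤a 0≤b)

  0≤i*i : ∀ i → 0ℤ ≤ i * i
  0≤i*i (+ n)    = *-0≤ {+ n} {+ n} (+≤+ z≤n) (+≤+ z≤n)
  0≤i*i -[1+ n ] = ≤-trans (0≤i*i (- -[1+ n ])) (≤-reflexive (neg*neg -[1+ n ]))
    where
    neg*neg : ∀ i → - i * - i ≡ i * i
    neg*neg = solve-∀

  i*i≤0⇒i≡0 : ∀ i → i * i ≤ 0ℤ → i ≡ 0ℤ
  i*i≤0⇒i≡0 i i*i≤0 with i*j≡0⇒i≡0∨j≡0 i (≤-antisym i*i≤0 (0≤i*i i))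
  ... | inj₁ i≡0 = i≡0
  ... | inj₂ i≡0 = i≡0

  i≡-i⇒i≡0 : ∀ {i} → i ≡ - i → i ≡ 0ℤ
  i≡-i⇒i≡0 {i} i≡-i with i*j≡0⇒i≡0∨j≡0 (+ 2) (trans (double i) (trans (cong (_+_ i) i≡-i) (+-inverseʳ i)))
    where
    double : ∀ i → + 2 * i ≡ i + i
    double = solve-∀
  ... | inj₂ i≡0 = i≡0

  *-self-mono-≤ : ∀ {a b} → 0ℤ ≤ a → a ≤ b → a * a ≤ b * b
  *-self-mono-≤ {a} {b} 0≤a a≤b =
    ≤-trans (*-monoˡ-≤-0≤ 0≤a a≤b) (≤-trans (≤-reflexive (*-comm a b)) (*-monoˡ-≤-0≤ (≤-trans 0≤a a≤b) a≤b))

  am-gm : ∀ x w → + 4 * w * (x - w) ≤ x * x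
  am-gm x w = 0≤i-j⇒j≤i (≤-trans (0≤i*i (x - + 2 * w)) (≤-reflexive (square x w)))
    where
    square : ∀ x w → (x - + 2 * w) * (x - + 2 * w) ≡ x * x - + 4 * w * (x - w)
    square = solve-∀

module Iverson where

  open import Data.Nat using (z≤n)
  open import Data.Integer using (ℤ; +_; _*_; 0ℤ; 1ℤ; _≤_; +≤+)
  open import Data.Integer.Properties using (≤-refl)
  open import Data.Empty using (⊥-elim)
  open import Relation.Binary.PropositionalEquality using (_≡_; refl)
  open import Relation.Nullary using (Dec; yes; no; ¬_)
  open import Relation.Nullary.Decidable using (_×-dec_)

  [_] : {P : Set} → Dec P → ℤ
  [ d ] = + indicator d

  [yes] : {P : Set} {d : Dec P} → P → [ d ] ≡ 1ℤ
  [yes] {d = yes _} p = refl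
  [yes] {d = no ¬p} p = ⊥-elim (¬p p)

  [no] : {P : Set} {d : Dec P} → ¬ P → [ d ] ≡ 0ℤ
  [no] {d = yes p} ¬p = ⊥-elim (¬p p)
  [no] {d = no _}  ¬p = refl

  bracket-⇔ : {P Q : Set} (p : Dec P) (q : Dec Q) → (P → Q) → (Q → P) → [ p ] ≡ [ q ]
  bracket-⇔ (yes _) (yes _) P→Q Q→P = refl
  bracket-⇔ (yes p) (no ¬q) P→Q Q→P = ⊥-elim (¬q (P→Q p))
  bracket-⇔ (no ¬p) (yes q) P→Q Q→P = ⊥-elim (¬p (Q→P q))
  bracket-⇔ (no _)  (no _)  P→Q Q→P = refl

  bracket-mono : {P Q : Set} (p : Dec P) (q : Dec Q) → (P → Q) → [ p ] ≤ [ q ]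
  bracket-mono (yes _) (yes _) P→Q = ≤-refl
  bracket-mono (yes p) (no ¬q) P→Q = ⊥-elim (¬q (P→Q p))
  bracket-mono (no _)  _       P→Q = +≤+ z≤n

  [×-dec] : {P Q : Set} (p : Dec P) (q : Dec Q) → [ p ×-dec q ] ≡ [ p ] * [ q ]
  [×-dec] (yes _) (yes _) = refl
  [×-dec] (yes _) (no _)  = refl
  [×-dec] (no _)  (yes _) = refl
  [×-dec] (no _)  (no _)  = refl

module Summation where

  open import Data.Nat as ℕ using (ℕ; zero; suc)
  open import Data.Fin using (Fin; zero; suc; _≟_; _↑ˡ_; _↑ʳ_; combine)
  open import Data.Integer as ℤ using (ℤ; +_; _+_; _*_; -_; _-_; 0ℤ; 1ℤ; _≤_)
  open import Data.Integer.Properties as ℤ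
    using (+-*-semiring; ≤-refl; +-mono-≤; +-assoc; +-identityˡ; *-identityˡ; *-zeroˡ; pos-+)
  open import Data.Integer.Tactic.RingSolver using (solve-∀)
  open import Relation.Binary.PropositionalEquality
    using (_≡_; refl; sym; trans; cong; cong₂; subst; subst₂; module ≡-Reasoning)
  open import Relation.Nullary using (yes; no)
  open import Function using (_∘_)
  open IntegerOrder
  open Iverson

  open import Algebra.Properties.Semiring.Sum +-*-semiring public
    using (sum; sum-syntax; sum-cong-≗; ∑-distrib-+; ∑-comm; *-distribˡ-sum; *-distribʳ-sum)

  +-sumFin : ∀ n (f : Fin n → ℕ) → + sumFin n f ≡ ∑[ i < n ] (+ f i)
  +-sumFin zero    f = refl
  +-sumFin (suc n) f = trans (pos-+ (f zero) _) (cong (_+_ (+ f zero)) (+-sumFin n (f ∘ suc)))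

  ∑-neg : ∀ n (f : Fin n → ℤ) → ∑[ i < n ] (- f i) ≡ - ∑[ i < n ] f i
  ∑-neg zero    f = refl
  ∑-neg (suc n) f = trans (cong (_+_ (- f zero)) (∑-neg n (f ∘ suc))) (sym (ℤ.neg-distrib-+ (f zero) _))

  ∑-distrib-- : ∀ n (f g : Fin n → ℤ) → ∑[ i < n ] (f i - g i) ≡ ∑[ i < n ] f i - ∑[ i < n ] g i
  ∑-distrib-- n f g = trans (∑-distrib-+ f (-_ ∘ g)) (cong (_+_ (sum f)) (∑-neg n g))

  ∑-*ˡ : ∀ n c (f : Fin n → ℤ) → ∑[ i < n ] (c * f i) ≡ c * ∑[ i < n ] f i
  ∑-*ˡ n c f = sym (*-distribˡ-sum c f)

  ∑-*ʳ : ∀ n c (f : Fin n → ℤ) → ∑[ i < n ] (f i * c) ≡ ∑[ i < n ] f i * c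
  ∑-*ʳ n c f = sym (*-distribʳ-sum c f)

  ∑-const : ∀ n c → ∑[ i < n ] c ≡ + n * c
  ∑-const zero    c = sym (*-zeroˡ c)
  ∑-const (suc n) c = trans (cong (_+_ c) (∑-const n c)) (lemma (+ n) c)
    where
    lemma : ∀ n c → c + n * c ≡ (1ℤ + n) * c
    lemma = solve-∀

  ∑-product : ∀ m n (f : Fin m → ℤ) (g : Fin n → ℤ) →
              ∑[ i < m ] ∑[ j < n ] (f i * g j) ≡ ∑[ i < m ] f i * ∑[ j < n ] g j
  ∑-product m n f g = trans (sum-cong-≗ (λ i → ∑-*ˡ n (f i) g)) (∑-*ʳ m (∑[ j < n ] g j) f)

  ∑-mono-≤ : ∀ n {f g : Fin n → ℤ} → (∀ i → f i ≤ g i) → ∑[ i < n ] f i ≤ ∑[ i < n ] g i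
  ∑-mono-≤ zero    f≤g = ≤-refl
  ∑-mono-≤ (suc n) f≤g = +-mono-≤ (f≤g zero) (∑-mono-≤ n (f≤g ∘ suc))

  ∑-nonNeg : ∀ n {f : Fin n → ℤ} → (∀ i → 0ℤ ≤ f i) → 0ℤ ≤ ∑[ i < n ] f i
  ∑-nonNeg n {f} 0≤f = subst (_≤ sum f) (trans (∑-const n 0ℤ) (ℤ.*-zeroʳ (+ n))) (∑-mono-≤ n 0≤f)

  ∑-[≟]-* : ∀ n (i : Fin n) (f : Fin n → ℤ) → ∑[ j < n ] ([ i ≟ j ] * f j) ≡ f i
  ∑-[≟]-* (suc n) zero    f = begin
    1ℤ * f zero + ∑[ j < n ] ([ zero ≟ suc j ] * f (suc j))
      ≡⟨ cong₂ _+_ (*-identityˡ (f zero)) (sum-cong-≗ (λ j → *-zeroˡ (f (suc j)))) ⟩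
    f zero + ∑[ j < n ] 0ℤ
      ≡⟨ cong (_+_ (f zero)) (trans (∑-const n 0ℤ) (ℤ.*-zeroʳ (+ n))) ⟩
    f zero + 0ℤ
      ≡⟨ ℤ.+-identityʳ (f zero) ⟩
    f zero ∎
    where open ≡-Reasoning
  ∑-[≟]-* (suc n) (suc i) f = trans (+-identityˡ _) (trans (sum-cong-≗ shift) (∑-[≟]-* n i (f ∘ suc)))
    where
    shift : ∀ j → [ suc i ≟ suc j ] * f (suc j) ≡ [ i ≟ j ] * f (suc j)
    shift j with i ≟ j
    ... | yes _ = refl
    ... | no  _ = refl

  ∑-[≢] : ∀ n → ∑[ i < n ] ∑[ j < n ] (1ℤ - [ i ≟ j ]) ≡ + n * + n - + n
  ∑-[≢] n = begin
    ∑[ i < n ] ∑[ j < n ] (1ℤ - [ i ≟ j ])              ≡⟨ sum-cong-≗ (λ i → ∑-distrib-- n (λ _ → 1ℤ) (λ j → [ i ≟ j ])) ⟩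
    ∑[ i < n ] (∑[ j < n ] 1ℤ - ∑[ j < n ] [ i ≟ j ])   ≡⟨ sum-cong-≗ (λ i → cong₂ _-_ (∑-const n 1ℤ) (∑[≟] i)) ⟩
    ∑[ i < n ] (+ n * 1ℤ - 1ℤ)                          ≡⟨ ∑-const n (+ n * 1ℤ - 1ℤ) ⟩
    + n * (+ n * 1ℤ - 1ℤ)                               ≡⟨ collect (+ n) ⟩
    + n * + n - + n                                     ∎
    where
    open ≡-Reasoning
    ∑[≟] : ∀ i → ∑[ j < n ] [ i ≟ j ] ≡ 1ℤ
    ∑[≟] i = trans (sum-cong-≗ (λ j → sym (ℤ.*-identityʳ [ i ≟ j ]))) (∑-[≟]-* n i (λ _ → 1ℤ))
    collect : ∀ n → n * (n * 1ℤ - 1ℤ) ≡ n * n - n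
    collect = solve-∀

  ∑-split : ∀ p q (g : Fin (p ℕ.+ q) → ℤ) →
            ∑[ i < p ℕ.+ q ] g i ≡ ∑[ i < p ] g (i ↑ˡ q) + ∑[ j < q ] g (p ↑ʳ j)
  ∑-split zero    q g = sym (+-identityˡ _)
  ∑-split (suc p) q g = trans (cong (_+_ (g zero)) (∑-split p q (g ∘ suc))) (sym (+-assoc (g zero) _ _))

  ∑-combine : ∀ p k (g : Fin (p ℕ.* k) → ℤ) → ∑[ i < p ℕ.* k ] g i ≡ ∑[ x < p ] ∑[ y < k ] g (combine x y)
  ∑-combine zero    k g = refl
  ∑-combine (suc p) k g =
    trans (∑-split k (p ℕ.* k) g) (cong (_+_ (∑[ y < k ] g (y ↑ˡ p ℕ.* k))) (∑-combine p k (g ∘ (k ↑ʳ_))))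

  ∑-distrib-+-2* : ∀ n (f g h : Fin n → ℤ) →
                   ∑[ i < n ] (f i + g i - + 2 * h i) ≡ sum f + sum g - + 2 * sum h
  ∑-distrib-+-2* n f g h =
    trans (∑-distrib-- n (λ i → f i + g i) (λ i → + 2 * h i)) (cong₂ _-_ (∑-distrib-+ f g) (∑-*ˡ n (+ 2) h))

  cauchy-schwarz-weighted : ∀ n (w u v : Fin n → ℤ) → (∀ i → 0ℤ ≤ w i) →
    ∑[ i < n ] (w i * u i * v i) * ∑[ i < n ] (w i * u i * v i)
      ≤ ∑[ i < n ] (w i * (u i * u i)) * ∑[ i < n ] (w i * (v i * v i))
  cauchy-schwarz-weighted n w u v 0≤w =
    ℤ.0≤i-j⇒j≤i (*-cancelˡ-≤-0< {+ 2} (ℤ.+<+ (ℕ.s≤s ℕ.z≤n)) (subst₂ _≤_ (sym (ℤ.*-zeroʳ (+ 2))) lagrange 0≤lhs))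
    where
    a b c : Fin n → ℤ
    a i = w i * (u i * u i)
    b i = w i * (v i * v i)
    c i = w i * u i * v i
    term : Fin n → Fin n → ℤ
    term i j = w i * w j * ((u i * v j - u j * v i) * (u i * v j - u j * v i))
    0≤lhs : 0ℤ ≤ ∑[ i < n ] ∑[ j < n ] term i j
    0≤lhs = ∑-nonNeg n (λ i → ∑-nonNeg n (λ j → *-0≤ (*-0≤ (0≤w i) (0≤w j)) (0≤i*i (u i * v j - u j * v i))))
    expand : ∀ wi wj ui uj vi vj →
      wi * wj * ((ui * vj - uj * vi) * (ui * vj - uj * vi))
        ≡ (wi * (ui * ui)) * (wj * (vj * vj)) + (wj * (uj * uj)) * (wi * (vi * vi)) - + 2 * ((wi * ui * vi) * (wj * uj * vj))
    expand = solve-∀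
    lagrange : ∑[ i < n ] ∑[ j < n ] term i j ≡ + 2 * (sum a * sum b - sum c * sum c)
    lagrange = begin
      ∑[ i < n ] ∑[ j < n ] term i j
        ≡⟨ sum-cong-≗ (λ i → trans (sum-cong-≗ (λ j → expand (w i) (w j) (u i) (u j) (v i) (v j)))
                                   (∑-distrib-+-2* n (λ j → a i * b j) (λ j → a j * b i) (λ j → c i * c j))) ⟩
      ∑[ i < n ] (∑[ j < n ] (a i * b j) + ∑[ j < n ] (a j * b i) - + 2 * ∑[ j < n ] (c i * c j))
        ≡⟨ ∑-distrib-+-2* n (λ i → ∑[ j < n ] (a i * b j)) (λ i → ∑[ j < n ] (a j * b i)) (λ i → ∑[ j < n ] (c i * c j)) ⟩
      ∑[ i < n ] ∑[ j < n ] (a i * b j) + ∑[ i < n ] ∑[ j < n ] (a j * b i) - + 2 * ∑[ i < n ] ∑[ j < n ] (c i * c j)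
        ≡⟨ cong₂ (λ x y → x - + 2 * y) (cong₂ _+_ (∑-product n n a b) (trans (∑-comm (λ i j → a j * b i)) (∑-product n n a b)))
                                       (∑-product n n c c) ⟩
      sum a * sum b + sum a * sum b - + 2 * (sum c * sum c)
        ≡⟨ collect (sum a) (sum b) (sum c) ⟩
      + 2 * (sum a * sum b - sum c * sum c) ∎
      where
      open ≡-Reasoning
      collect : ∀ x y z → x * y + x * y - + 2 * (z * z) ≡ + 2 * (x * y - z * z)
      collect = solve-∀

  cauchy-schwarz : ∀ n (u v : Fin n → ℤ) →
    ∑[ i < n ] (u i * v i) * ∑[ i < n ] (u i * v i) ≤ ∑[ i < n ] (u i * u i) * ∑[ i < n ] (v i * v i)
  cauchy-schwarz n u v = subst₂ _≤_ (cong₂ _*_ ∑uv ∑uv) (cong₂ _*_ (∑1* (λ i → u i * u i)) (∑1* (λ i → v i * v i)))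
                            (cauchy-schwarz-weighted n (λ _ → 1ℤ) u v (λ _ → ℤ.+≤+ ℕ.z≤n))
    where
    ∑1* : ∀ g → ∑[ i < n ] (1ℤ * g i) ≡ sum g
    ∑1* g = sum-cong-≗ (λ i → *-identityˡ (g i))
    ∑uv : ∑[ i < n ] (1ℤ * u i * v i) ≡ ∑[ i < n ] (u i * v i)
    ∑uv = sum-cong-≗ (λ i → cong (_* v i) (*-identityˡ (u i)))

  ∑∑-antisym : ∀ n (s : Fin n → Fin n → ℤ) → (∀ i j → s j i ≡ - s i j) → (g : Fin n → ℤ) →
               ∑[ i < n ] ∑[ j < n ] (s i j * g j) ≡ - ∑[ i < n ] ∑[ j < n ] (s i j * g i)
  ∑∑-antisym n s antisym g = begin
    ∑[ i < n ] ∑[ j < n ] (s i j * g j)        ≡⟨ ∑-comm (λ i j → s i j * g j) ⟩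
    ∑[ j < n ] ∑[ i < n ] (s i j * g j)        ≡⟨ sum-cong-≗ (λ j → sum-cong-≗ (λ i → flip j i)) ⟩
    ∑[ j < n ] ∑[ i < n ] (- (s j i * g j))    ≡⟨ sum-cong-≗ (λ j → ∑-neg n (λ i → s j i * g j)) ⟩
    ∑[ j < n ] (- ∑[ i < n ] (s j i * g j))    ≡⟨ ∑-neg n (λ j → ∑[ i < n ] (s j i * g j)) ⟩
    - ∑[ j < n ] ∑[ i < n ] (s j i * g j)      ∎
    where
    open ≡-Reasoning
    flip : ∀ j i → s i j * g j ≡ - (s j i * g j)
    flip j i = trans (cong (_* g j) (antisym j i)) (sym (ℤ.neg-distribˡ-* (s j i) (g j)))

  power-mean-cube : ∀ k (y : Fin k → ℤ) → (∀ p → 0ℤ ≤ y p) →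
                    sum y * sum y * sum y ≤ + k * + k * ∑[ p < k ] (y p * (y p * y p))
  power-mean-cube k y 0≤y with sum y ℤ.≟ 0ℤ
  ... | yes Y₁≡0 = subst (_≤ + k * + k * ∑[ p < k ] (y p * (y p * y p))) (cong (λ z → z * z * z) (sym Y₁≡0))
                         (*-0≤ (0≤i*i (+ k)) (∑-nonNeg k (λ p → *-0≤ (0≤y p) (0≤i*i (y p)))))
  ... | no  Y₁≢0 = *-cancelˡ-≤-0< 0<Y₁ (begin
    Y₁ * (Y₁ * Y₁ * Y₁)        ≡⟨ regroup Y₁ ⟩
    (Y₁ * Y₁) * (Y₁ * Y₁)      ≤⟨ *-self-mono-≤ (0≤i*i Y₁) Y₁²≤KY₂ ⟩
    (K * Y₂) * (K * Y₂)        ≡⟨ square-* K Y₂ ⟩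
    K * K * (Y₂ * Y₂)          ≤⟨ *-monoˡ-≤-0≤ (0≤i*i K) Y₂²≤Y₃Y₁ ⟩
    K * K * (Y₃ * Y₁)          ≡⟨ rotate K Y₃ Y₁ ⟩
    Y₁ * (K * K * Y₃)          ∎)
    where
    open ℤ.≤-Reasoning
    K = + k
    Y₁ = sum y
    Y₂ = ∑[ p < k ] (y p * y p)
    Y₃ = ∑[ p < k ] (y p * (y p * y p))
    0<Y₁ : 0ℤ ℤ.< Y₁
    0<Y₁ = ℤ.≤∧≢⇒< (∑-nonNeg k 0≤y) (Y₁≢0 ∘ sym)
    Y₁²≤KY₂ : Y₁ * Y₁ ≤ K * Y₂
    Y₁²≤KY₂ = subst₂ _≤_ (cong₂ _*_ ∑1*y ∑1*y) (cong (_* Y₂) ∑1*1) (cauchy-schwarz k (λ _ → 1ℤ) y)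
      where
      ∑1*y : ∑[ p < k ] (1ℤ * y p) ≡ Y₁
      ∑1*y = sum-cong-≗ (λ p → *-identityˡ (y p))
      ∑1*1 : ∑[ p < k ] (1ℤ * 1ℤ) ≡ K
      ∑1*1 = trans (∑-const k 1ℤ) (ℤ.*-identityʳ K)
    Y₂²≤Y₃Y₁ : Y₂ * Y₂ ≤ Y₃ * Y₁
    Y₂²≤Y₃Y₁ = subst₂ _≤_ (cong₂ _*_ ∑y*y*1 ∑y*y*1) (cong (Y₃ *_) ∑y*1)
                           (cauchy-schwarz-weighted k y y (λ _ → 1ℤ) 0≤y)
      where
      ∑y*y*1 : ∑[ p < k ] (y p * y p * 1ℤ) ≡ Y₂
      ∑y*y*1 = sum-cong-≗ (λ p → ℤ.*-identityʳ (y p * y p))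
      ∑y*1 : ∑[ p < k ] (y p * (1ℤ * 1ℤ)) ≡ Y₁
      ∑y*1 = sum-cong-≗ (λ p → ℤ.*-identityʳ (y p))
    regroup : ∀ a → a * (a * a * a) ≡ (a * a) * (a * a)
    regroup = solve-∀
    square-* : ∀ a b → (a * b) * (a * b) ≡ a * a * (b * b)
    square-* = solve-∀
    rotate : ∀ a b c → a * a * (b * c) ≡ c * (a * a * b)
    rotate = solve-∀

module OrderType where

  open import Data.Nat using (ℕ; suc; _+_; _≤_; _<_; _⊓_; _⊔_; z≤n; s≤s)
  open import Data.Nat.Properties
    using (_<?_; _≟_; ≤-refl; ≤-trans; <-≤-trans; <⇒≤; <-irrefl; <-cmp; +-mono-≤; +-mono-≤-<;
           +-suc; ≤-reflexive; mono-≤-distrib-⊓; mono-≤-distrib-⊔; ⊓-sel; ⊔-sel)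
  open import Data.List using (List; []; _∷_; length)
  open import Data.List.Membership.Propositional using (_∈_)
  open import Data.List.Relation.Unary.Any using (here; there)
  open import Data.Sum using (inj₁; inj₂)
  open import Relation.Binary using (tri<; tri≈; tri>)
  open import Relation.Binary.PropositionalEquality using (_≡_; refl; sym; cong; subst)
  open import Relation.Nullary using (Dec; yes; no)
  open import Data.Empty using (⊥-elim)
  open Iverson

  rank : List ℕ → ℕ → ℕ
  rank []       y = 0
  rank (x ∷ xs) y = indicator (x <? y) + rank xs y

  private
    indicator≤1 : {P : Set} (d : Dec P) → indicator d ≤ 1
    indicator≤1 (yes _) = s≤s z≤n
    indicator≤1 (no _)  = z≤n

    indicator-<-mono : ∀ x {y z} → y ≤ z → indicator (x <? y) ≤ indicator (x <? z)
    indicator-<-mono x {y} {z} y≤z with x <? y | x <? z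
    ... | yes _   | yes _   = ≤-refl
    ... | yes x<y | no  x≮z = ⊥-elim (x≮z (<-≤-trans x<y y≤z))
    ... | no _    | _       = z≤n

    indicator-<-irrefl : ∀ x → indicator (x <? x) ≡ 0
    indicator-<-irrefl x with x <? x
    ... | yes x<x = ⊥-elim (<-irrefl refl x<x)
    ... | no _    = refl

  rank-mono-≤ : ∀ xs {y z} → y ≤ z → rank xs y ≤ rank xs z
  rank-mono-≤ []       y≤z = z≤n
  rank-mono-≤ (x ∷ xs) y≤z = +-mono-≤ (indicator-<-mono x y≤z) (rank-mono-≤ xs y≤z)

  rank-mono-< : ∀ xs {y z} → y ∈ xs → y < z → rank xs y < rank xs z
  rank-mono-< (x ∷ xs) {y} {z} (here refl) y<z with y <? z
  ... | yes _   = subst (_< suc (rank xs z)) (sym (cong (_+ rank xs y) (indicator-<-irrefl y)))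
                         (s≤s (rank-mono-≤ xs (<⇒≤ y<z)))
  ... | no y≮z  = ⊥-elim (y≮z y<z)
  rank-mono-< (x ∷ xs) (there y∈xs) y<z =
    +-mono-≤-< (indicator-<-mono x (<⇒≤ y<z)) (rank-mono-< xs y∈xs y<z)

  rank<length : ∀ xs {y} → y ∈ xs → rank xs y < length xs
  rank<length (x ∷ xs) {y} (here refl) =
    subst (_< suc (length xs)) (sym (cong (_+ rank xs y) (indicator-<-irrefl y))) (s≤s (rank≤length xs))
    where
    rank≤length : ∀ xs → rank xs y ≤ length xs
    rank≤length []       = z≤n
    rank≤length (x ∷ xs) = +-mono-≤ (indicator≤1 (x <? y)) (rank≤length xs)
  rank<length (x ∷ xs) {y} (there y∈xs) =
    ≤-trans (≤-reflexive (sym (+-suc _ _))) (+-mono-≤ (indicator≤1 (x <? y)) (rank<length xs y∈xs))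

  module _ (xs : List ℕ) where

    rank-<-reflects : ∀ {y z} → y ∈ xs → rank xs y < rank xs z → y < z
    rank-<-reflects {y} {z} y∈xs r< with <-cmp y z
    ... | tri< y<z _ _  = y<z
    ... | tri≈ _ refl _ = ⊥-elim (<-irrefl refl r<)
    ... | tri> _ _ z<y  = ⊥-elim (<-irrefl refl (<-≤-trans r< (rank-mono-≤ xs (<⇒≤ z<y))))

    rank-injective : ∀ {y z} → y ∈ xs → z ∈ xs → rank xs y ≡ rank xs z → y ≡ z
    rank-injective {y} {z} y∈xs z∈xs r≡ with <-cmp y z
    ... | tri< y<z _ _ = ⊥-elim (<-irrefl r≡ (rank-mono-< xs y∈xs y<z))
    ... | tri≈ _ y≡z _ = y≡z
    ... | tri> _ _ z<y = ⊥-elim (<-irrefl (sym r≡) (rank-mono-< xs z∈xs z<y))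

    [<?]-rank : ∀ {y z} → y ∈ xs → [ rank xs y <? rank xs z ] ≡ [ y <? z ]
    [<?]-rank y∈xs = bracket-⇔ (_ <? _) (_ <? _) (rank-<-reflects y∈xs) (rank-mono-< xs y∈xs)

    [≟]-rank : ∀ {y z} → y ∈ xs → z ∈ xs → [ rank xs y ≟ rank xs z ] ≡ [ y ≟ z ]
    [≟]-rank y∈xs z∈xs = bracket-⇔ (_ ≟ _) (_ ≟ _) (rank-injective y∈xs z∈xs) (cong (rank xs))

    rank-⊓ : ∀ y z → rank xs (y ⊓ z) ≡ rank xs y ⊓ rank xs z
    rank-⊓ = mono-≤-distrib-⊓ (rank-mono-≤ xs)

    rank-⊔ : ∀ y z → rank xs (y ⊔ z) ≡ rank xs y ⊔ rank xs z
    rank-⊔ = mono-≤-distrib-⊔ (rank-mono-≤ xs)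

    ⊓-∈ : ∀ {y z} → y ∈ xs → z ∈ xs → y ⊓ z ∈ xs
    ⊓-∈ {y} {z} y∈xs z∈xs with ⊓-sel y z
    ... | inj₁ y⊓z≡y = subst (_∈ xs) (sym y⊓z≡y) y∈xs
    ... | inj₂ y⊓z≡z = subst (_∈ xs) (sym y⊓z≡z) z∈xs

    ⊔-∈ : ∀ {y z} → y ∈ xs → z ∈ xs → y ⊔ z ∈ xs
    ⊔-∈ {y} {z} y∈xs z∈xs with ⊔-sel y z
    ... | inj₁ y⊔z≡y = subst (_∈ xs) (sym y⊔z≡y) y∈xs
    ... | inj₂ y⊔z≡z = subst (_∈ xs) (sym y⊔z≡z) z∈xs

module Comparisons where

  open import Data.Nat as ℕ using (ℕ; suc)
  import Data.Nat.Properties as ℕ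
  open import Data.Nat.Properties using (_<?_)
  open import Data.Integer as ℤ using (ℤ; +_; _+_; _*_; -_; _-_; 0ℤ; 1ℤ)
  import Data.Integer.Properties as ℤ
  open import Data.Integer.Tactic.RingSolver using (solve-∀)
  open import Data.Sum using (inj₁; inj₂)
  open import Data.Empty using (⊥-elim)
  open import Relation.Binary.PropositionalEquality using (_≡_; refl; sym; trans; cong; cong₂)
  open import Relation.Nullary using (Dec; yes; no)
  open Iverson

  sgn : ℕ → ℕ → ℤ
  sgn x y = [ y <? x ] - [ x <? y ]

  sgn-antisym : ∀ x y → sgn y x ≡ - sgn x y
  sgn-antisym x y = flip [ y <? x ] [ x <? y ]
    where
    flip : ∀ a b → b - a ≡ - (a - b)
    flip = solve-∀

  dist : ℕ → ℕ → ℤ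
  dist x y = sgn x y * (+ x - + y)

  dist-sym : ∀ x y → dist x y ≡ dist y x
  dist-sym x y = flip [ y <? x ] [ x <? y ] (+ x) (+ y)
    where
    flip : ∀ a b u v → (a - b) * (u - v) ≡ (b - a) * (v - u)
    flip = solve-∀

  dist-≤ : ∀ {x y} → x ℕ.≤ y → dist x y ≡ + y - + x
  dist-≤ {x} {y} x≤y with ℕ.m≤n⇒m<n∨m≡n x≤y
  ... | inj₂ refl = trans (cong (sgn x x *_) (ℤ.+-inverseʳ (+ x)))
                          (trans (ℤ.*-zeroʳ (sgn x x)) (sym (ℤ.+-inverseʳ (+ x))))
  ... | inj₁ x<y  = trans (cong (_* (+ x - + y)) (cong₂ _-_ ([no] {d = y <? x} (ℕ.<⇒≯ x<y)) ([yes] {d = x <? y} x<y)))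
                          (negate (+ x) (+ y))
    where
    negate : ∀ a b → (0ℤ - 1ℤ) * (a - b) ≡ b - a
    negate = solve-∀

  dist*dist : ∀ x y → dist x y * dist x y ≡ (+ x - + y) * (+ x - + y)
  dist*dist x y with ℕ.≤-total x y
  ... | inj₁ x≤y rewrite dist-≤ x≤y = flip (+ x) (+ y)
    where
    flip : ∀ a b → (b - a) * (b - a) ≡ (a - b) * (a - b)
    flip = solve-∀
  ... | inj₂ y≤x rewrite dist-sym x y | dist-≤ y≤x = refl

  dist-suc : ∀ x y → dist (suc x) (suc y) ≡ dist x y
  dist-suc x y = cong₂ _*_ (cong₂ _-_ (bracket-⇔ (suc y <? suc x) (y <? x) ℕ.s<s⁻¹ ℕ.s<s)
                                      (bracket-⇔ (suc x <? suc y) (x <? y) ℕ.s<s⁻¹ ℕ.s<s))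
                           (trans (cong₂ _-_ (ℤ.pos-+ 1 x) (ℤ.pos-+ 1 y)) (cancel (+ x) (+ y)))
    where
    cancel : ∀ a b → (1ℤ + a) - (1ℤ + b) ≡ a - b
    cancel = solve-∀

  private
    dist-*ˡ-≤ : ∀ c {x y} → x ℕ.≤ y → dist (c ℕ.* x) (c ℕ.* y) ≡ + c * dist x y
    dist-*ˡ-≤ c {x} {y} x≤y = trans (dist-≤ (ℕ.*-monoʳ-≤ c x≤y))
      (trans (cong₂ _-_ (ℤ.pos-* c y) (ℤ.pos-* c x)) (trans (factor (+ c) (+ y) (+ x)) (cong (+ c *_) (sym (dist-≤ x≤y)))))
      where
      factor : ∀ c u v → c * u - c * v ≡ c * (u - v)
      factor = solve-∀

  dist-*ˡ : ∀ c x y → dist (c ℕ.* x) (c ℕ.* y) ≡ + c * dist x y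
  dist-*ˡ c x y with ℕ.≤-total x y
  ... | inj₁ x≤y = dist-*ˡ-≤ c x≤y
  ... | inj₂ y≤x = trans (dist-sym (c ℕ.* x) (c ℕ.* y)) (trans (dist-*ˡ-≤ c y≤x) (cong (+ c *_) (dist-sym y x)))

  xor : ℤ → ℤ → ℤ
  xor u v = u + v - + 2 * (u * v)

  xor-comm : ∀ u v → xor u v ≡ xor v u
  xor-comm = comm
    where
    comm : ∀ u v → u + v - + 2 * (u * v) ≡ v + u - + 2 * (v * u)
    comm = solve-∀

  xor-→ : {A B : Set} (a : Dec A) (b : Dec B) → (A → B) → xor [ a ] [ b ] ≡ [ b ] - [ a ]
  xor-→ (yes _) (yes _) A→B = refl
  xor-→ (yes a) (no ¬b) A→B = ⊥-elim (¬b (A→B a))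
  xor-→ (no _)  (yes _) A→B = refl
  xor-→ (no _)  (no _)  A→B = refl

  -- For y ∉ {a, c} this is [ y lies strictly between a and c ].
  between : ℕ → ℕ → ℕ → ℤ
  between a y c = xor [ y <? a ] [ y <? c ]

module OrderIdentities where

  open import Data.Nat using (ℕ; _<_; _⊓_; _⊔_)
  open import Data.Nat.Properties using (_<?_; _≟_; allUpTo?)
  open import Data.Integer as ℤ using (ℤ; _+_; _*_; _-_; 1ℤ)
  open import Data.List using (List; []; _∷_)
  open import Data.List.Membership.Propositional using (_∈_)
  open import Data.List.Relation.Unary.Any using (here; there)
  open import Data.Product using (_×_)
  open import Data.Unit using (tt)
  open import Relation.Binary.PropositionalEquality
    using (_≡_; _≢_; refl; sym; trans; cong; cong₂; module ≡-Reasoning)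
  open import Relation.Nullary using (Dec; ¬?)
  open import Relation.Nullary.Decidable using (_×-dec_; _→-dec_; toWitness)
  open import Function using (_∘_)
  open Iverson
  open OrderType
  open Comparisons

  -- The same test as `crosses?` in Defs, so [ interleave? (P i) (Q j) (P i′) (Q j′) ] is a
  -- summand of `crossings` when P and Q are the positions of the two classes.
  interleave? : (a b c d : ℕ) → Dec (a ⊓ b < c ⊓ d × (c ⊓ d < a ⊔ b × a ⊔ b < c ⊔ d))
  interleave? a b c d = (a ⊓ b <? c ⊓ d) ×-dec ((c ⊓ d <? a ⊔ b) ×-dec (a ⊔ b <? c ⊔ d))

  [interleave?] : ∀ a b c d →
    [ interleave? a b c d ] ≡ [ a ⊓ b <? c ⊓ d ] * ([ c ⊓ d <? a ⊔ b ] * [ a ⊔ b <? c ⊔ d ])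
  [interleave?] a b c d =
    trans ([×-dec] (a ⊓ b <? c ⊓ d) _) (cong (_*_ [ a ⊓ b <? c ⊓ d ]) ([×-dec] (c ⊓ d <? a ⊔ b) _))

  chordsCross : ℕ → ℕ → ℕ → ℕ → ℤ
  chordsCross a b c d = [ interleave? a b c d ] + [ interleave? c d a b ]

  -- Of the three ways to pair up four distinct points on a circle, exactly one gives crossing
  -- chords; the pairing {ac, bd} crosses iff exactly one of b, d lies between a and c.
  crossingPairings : ℕ → ℕ → ℕ → ℕ → ℤ
  crossingPairings a b c d = chordsCross a b c d + chordsCross a d c b + xor (between a b c) (between a d c)

  -- For a < b < c the three products of signs are 1, -1 and 1; the last term covers a = b = c.
  triple : ℕ → ℕ → ℕ → ℤ
  triple a b c = sgn a b * sgn a c + sgn b a * sgn b c + sgn c a * sgn c b + [ a ≟ b ] * [ a ≟ c ]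

  module _ (xs : List ℕ) where

    private
      r = rank xs

    sgn-rank : ∀ {y z} → y ∈ xs → z ∈ xs → sgn (r y) (r z) ≡ sgn y z
    sgn-rank y∈xs z∈xs = cong₂ _-_ ([<?]-rank xs z∈xs) ([<?]-rank xs y∈xs)

    between-rank : ∀ {a y c} → y ∈ xs → between (r a) (r y) (r c) ≡ between a y c
    between-rank y∈xs = cong₂ xor ([<?]-rank xs y∈xs) ([<?]-rank xs y∈xs)

    interleave?-rank : ∀ {a b c d} → a ∈ xs → b ∈ xs → c ∈ xs → d ∈ xs →
                       [ interleave? (r a) (r b) (r c) (r d) ] ≡ [ interleave? a b c d ]
    interleave?-rank {a} {b} {c} {d} a∈ b∈ c∈ d∈ = begin
      [ interleave? (r a) (r b) (r c) (r d) ]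
        ≡⟨ [interleave?] (r a) (r b) (r c) (r d) ⟩
      [ r a ⊓ r b <? r c ⊓ r d ] * ([ r c ⊓ r d <? r a ⊔ r b ] * [ r a ⊔ r b <? r c ⊔ r d ])
        ≡⟨ cong₂ _*_ (lift (rank-⊓ xs a b) (rank-⊓ xs c d) (⊓-∈ xs a∈ b∈))
                     (cong₂ _*_ (lift (rank-⊓ xs c d) (rank-⊔ xs a b) (⊓-∈ xs c∈ d∈))
                                (lift (rank-⊔ xs a b) (rank-⊔ xs c d) (⊔-∈ xs a∈ b∈))) ⟩
      [ a ⊓ b <? c ⊓ d ] * ([ c ⊓ d <? a ⊔ b ] * [ a ⊔ b <? c ⊔ d ])
        ≡⟨ [interleave?] a b c d ⟨
      [ interleave? a b c d ] ∎
      where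
      open ≡-Reasoning
      lift : ∀ {y z y′ z′} → r y ≡ y′ → r z ≡ z′ → y ∈ xs → [ y′ <? z′ ] ≡ [ y <? z ]
      lift refl refl y∈xs = [<?]-rank xs y∈xs

  -- Both identities only involve comparisons, so replacing the points by their ranks among
  -- themselves reduces them to these finitely many cases, decided by evaluation.
  private
    triple-small : ∀ {a} → a < 3 → ∀ {b} → b < 3 → ∀ {c} → c < 3 → triple a b c ≡ 1ℤ
    triple-small = toWitness {a? = allUpTo? (λ a → allUpTo? (λ b → allUpTo? (λ c →
                     triple a b c ℤ.≟ 1ℤ) 3) 3) 3} tt

    crossingPairings-small : ∀ {a} → a < 4 → ∀ {b} → b < 4 → ∀ {c} → c < 4 → ∀ {d} → d < 4 →
      a ≢ b → a ≢ d → c ≢ b → c ≢ d → crossingPairings a b c d ≡ (1ℤ - [ a ≟ c ]) * (1ℤ - [ b ≟ d ])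
    crossingPairings-small = toWitness {a? = allUpTo? (λ a → allUpTo? (λ b → allUpTo? (λ c → allUpTo? (λ d →
      ¬? (a ≟ b) →-dec ¬? (a ≟ d) →-dec ¬? (c ≟ b) →-dec ¬? (c ≟ d) →-dec
      crossingPairings a b c d ℤ.≟ (1ℤ - [ a ≟ c ]) * (1ℤ - [ b ≟ d ])) 4) 4) 4) 4} tt

  triple≡1 : ∀ a b c → triple a b c ≡ 1ℤ
  triple≡1 a b c = trans (sym relabel) (triple-small (rank<length xs a∈) (rank<length xs b∈) (rank<length xs c∈))
    where
    xs = a ∷ b ∷ c ∷ []
    a∈ : a ∈ xs
    a∈ = here refl
    b∈ : b ∈ xs
    b∈ = there (here refl)
    c∈ : c ∈ xs
    c∈ = there (there (here refl))
    relabel : triple (rank xs a) (rank xs b) (rank xs c) ≡ triple a b c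
    relabel = cong₂ _+_ (cong₂ _+_ (cong₂ _+_ (cong₂ _*_ (sgn-rank xs a∈ b∈) (sgn-rank xs a∈ c∈))
                                              (cong₂ _*_ (sgn-rank xs b∈ a∈) (sgn-rank xs b∈ c∈)))
                                   (cong₂ _*_ (sgn-rank xs c∈ a∈) (sgn-rank xs c∈ b∈)))
                        (cong₂ _*_ ([≟]-rank xs a∈ b∈) ([≟]-rank xs a∈ c∈))

  one-crossing-pairing : ∀ {a b c d} → a ≢ b → a ≢ d → c ≢ b → c ≢ d →
                         crossingPairings a b c d ≡ (1ℤ - [ a ≟ c ]) * (1ℤ - [ b ≟ d ])
  one-crossing-pairing {a} {b} {c} {d} a≢b a≢d c≢b c≢d = begin
    crossingPairings a b c d
      ≡⟨ relabel ⟨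
    crossingPairings (r a) (r b) (r c) (r d)
      ≡⟨ crossingPairings-small (bound a∈) (bound b∈) (bound c∈) (bound d∈)
                                (distinct a∈ b∈ a≢b) (distinct a∈ d∈ a≢d) (distinct c∈ b∈ c≢b) (distinct c∈ d∈ c≢d) ⟩
    (1ℤ - [ r a ≟ r c ]) * (1ℤ - [ r b ≟ r d ])
      ≡⟨ cong₂ (λ x y → (1ℤ - x) * (1ℤ - y)) ([≟]-rank xs a∈ c∈) ([≟]-rank xs b∈ d∈) ⟩
    (1ℤ - [ a ≟ c ]) * (1ℤ - [ b ≟ d ]) ∎
    where
    open ≡-Reasoning
    xs = a ∷ b ∷ c ∷ d ∷ []
    r = rank xs
    a∈ : a ∈ xs
    a∈ = here refl
    b∈ : b ∈ xs
    b∈ = there (here refl)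
    c∈ : c ∈ xs
    c∈ = there (there (here refl))
    d∈ : d ∈ xs
    d∈ = there (there (there (here refl)))
    bound : ∀ {y} → y ∈ xs → r y < 4
    bound = rank<length xs
    distinct : ∀ {y z} → y ∈ xs → z ∈ xs → y ≢ z → r y ≢ r z
    distinct y∈ z∈ y≢z = y≢z ∘ rank-injective xs y∈ z∈
    chordsCross-rank : ∀ {y z u v} → y ∈ xs → z ∈ xs → u ∈ xs → v ∈ xs →
                       chordsCross (r y) (r z) (r u) (r v) ≡ chordsCross y z u v
    chordsCross-rank y∈ z∈ u∈ v∈ = cong₂ _+_ (interleave?-rank xs y∈ z∈ u∈ v∈) (interleave?-rank xs u∈ v∈ y∈ z∈)
    relabel : crossingPairings (r a) (r b) (r c) (r d) ≡ crossingPairings a b c d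
    relabel = cong₂ _+_ (cong₂ _+_ (chordsCross-rank a∈ b∈ c∈ d∈) (chordsCross-rank a∈ d∈ c∈ b∈))
                        (cong₂ xor (between-rank xs {a} {b} {c} b∈) (between-rank xs {a} {d} {c} d∈))

module Dispersion {m : ℕ} (f : Fin m → ℕ) where

  open import Data.Nat as ℕ using (z≤n)
  open import Data.Nat.Properties using (_≟_)
  open import Data.Integer as ℤ using (ℤ; +_; _+_; _*_; -_; _-_; 0ℤ; 1ℤ; _≤_)
  import Data.Integer.Properties as ℤ
  open import Data.Integer.Tactic.RingSolver using (solve-∀)
  open import Relation.Binary.PropositionalEquality using (sym; trans; cong; cong₂; module ≡-Reasoning)
  open IntegerOrder
  open Iverson
  open Summation
  open Comparisons
  open OrderIdentities

  M : ℤ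
  M = + m

  fℤ : Fin m → ℤ
  fℤ i = + f i

  s : Fin m → Fin m → ℤ
  s i j = sgn (f i) (f j)

  t : Fin m → ℤ
  t i = ∑[ j < m ] s i j

  G W T : ℤ
  G = ∑[ i < m ] ∑[ j < m ] dist (f i) (f j)
  W = ∑[ i < m ] ∑[ j < m ] ((fℤ i - fℤ j) * (fℤ i - fℤ j))
  T = ∑[ i < m ] (t i * t i)

  s-antisym : ∀ i j → s j i ≡ - s i j
  s-antisym i j = sgn-antisym (f i) (f j)

  ∑t≡0 : sum t ≡ 0ℤ
  ∑t≡0 = i≡-i⇒i≡0 (begin
    sum t                                  ≡⟨ sum-cong-≗ (λ i → sum-cong-≗ (λ j → sym (ℤ.*-identityʳ (s i j)))) ⟩
    ∑[ i < m ] ∑[ j < m ] (s i j * 1ℤ)     ≡⟨ ∑∑-antisym m s s-antisym (λ _ → 1ℤ) ⟩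
    - ∑[ i < m ] ∑[ j < m ] (s i j * 1ℤ)   ≡⟨ cong -_ (sum-cong-≗ (λ i → sum-cong-≗ (λ j → ℤ.*-identityʳ (s i j)))) ⟩
    - sum t                                ∎)
    where open ≡-Reasoning

  G≡2∑t*f : G ≡ + 2 * ∑[ i < m ] (t i * fℤ i)
  G≡2∑t*f = begin
    G
      ≡⟨ sum-cong-≗ (λ i → trans (sum-cong-≗ (λ j → distrib (s i j) (fℤ i) (fℤ j)))
                                 (∑-distrib-- m (λ j → s i j * fℤ i) (λ j → s i j * fℤ j))) ⟩
    ∑[ i < m ] (∑[ j < m ] (s i j * fℤ i) - ∑[ j < m ] (s i j * fℤ j))
      ≡⟨ ∑-distrib-- m (λ i → ∑[ j < m ] (s i j * fℤ i)) (λ i → ∑[ j < m ] (s i j * fℤ j)) ⟩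
    X - ∑[ i < m ] ∑[ j < m ] (s i j * fℤ j)
      ≡⟨ cong (_-_ X) (∑∑-antisym m s s-antisym fℤ) ⟩
    X - - X
      ≡⟨ double X ⟩
    + 2 * X
      ≡⟨ cong (+ 2 *_) (sum-cong-≗ (λ i → ∑-*ʳ m (fℤ i) (s i))) ⟩
    + 2 * ∑[ i < m ] (t i * fℤ i) ∎
    where
    open ≡-Reasoning
    X = ∑[ i < m ] ∑[ j < m ] (s i j * fℤ i)
    distrib : ∀ a b c → a * (b - c) ≡ a * b - a * c
    distrib = solve-∀
    double : ∀ x → x - - x ≡ + 2 * x
    double = solve-∀

  F Q : ℤ
  F = sum fℤ
  Q = ∑[ i < m ] (fℤ i * fℤ i)

  W≡2[MQ-F²] : W ≡ + 2 * (M * Q - F * F)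
  W≡2[MQ-F²] = begin
    W
      ≡⟨ sum-cong-≗ (λ i → trans (sum-cong-≗ (λ j → expand (fℤ i) (fℤ j)))
                                 (∑-distrib-+-2* m (λ _ → fℤ i * fℤ i) (λ j → fℤ j * fℤ j) (λ j → fℤ i * fℤ j))) ⟩
    ∑[ i < m ] (∑[ j < m ] (fℤ i * fℤ i) + Q - + 2 * ∑[ j < m ] (fℤ i * fℤ j))
      ≡⟨ ∑-distrib-+-2* m (λ i → ∑[ j < m ] (fℤ i * fℤ i)) (λ _ → Q) (λ i → ∑[ j < m ] (fℤ i * fℤ j)) ⟩
    ∑[ i < m ] ∑[ j < m ] (fℤ i * fℤ i) + ∑[ i < m ] Q - + 2 * ∑[ i < m ] ∑[ j < m ] (fℤ i * fℤ j)
      ≡⟨ cong₂ (λ a b → a - + 2 * b)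
               (cong₂ _+_ (trans (sum-cong-≗ (λ i → ∑-const m (fℤ i * fℤ i))) (∑-*ˡ m M (λ i → fℤ i * fℤ i))) (∑-const m Q))
               (∑-product m m fℤ fℤ) ⟩
    M * Q + M * Q - + 2 * (F * F)
      ≡⟨ collect M Q F ⟩
    + 2 * (M * Q - F * F) ∎
    where
    open ≡-Reasoning
    expand : ∀ a b → (a - b) * (a - b) ≡ a * a + b * b - + 2 * (a * b)
    expand = solve-∀
    collect : ∀ m q f → m * q + m * q - + 2 * (f * f) ≡ + 2 * (m * q - f * f)
    collect = solve-∀

  u : Fin m → ℤ
  u i = M * fℤ i - F

  ∑u*t≡M*∑t*f : ∑[ i < m ] (u i * t i) ≡ M * ∑[ i < m ] (t i * fℤ i)
  ∑u*t≡M*∑t*f = begin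
    ∑[ i < m ] (u i * t i)                                ≡⟨ sum-cong-≗ (λ i → distrib M (fℤ i) F (t i)) ⟩
    ∑[ i < m ] (M * (t i * fℤ i) - F * t i)               ≡⟨ ∑-distrib-- m (λ i → M * (t i * fℤ i)) (λ i → F * t i) ⟩
    (∑[ i < m ] (M * (t i * fℤ i))) - ∑[ i < m ] (F * t i) ≡⟨ cong₂ _-_ (∑-*ˡ m M (λ i → t i * fℤ i)) (∑-*ˡ m F t) ⟩
    M * A - F * sum t                                     ≡⟨ cong (λ z → M * A - F * z) ∑t≡0 ⟩
    M * A - F * 0ℤ                                        ≡⟨ drop (M * A) F ⟩
    M * A                                                 ∎
    where
    open ≡-Reasoning
    A = ∑[ i < m ] (t i * fℤ i)
    distrib : ∀ m a f t → (m * a - f) * t ≡ m * (t * a) - f * t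
    distrib = solve-∀
    drop : ∀ x f → x - f * 0ℤ ≡ x
    drop = solve-∀

  2∑u²≡M*W : + 2 * ∑[ i < m ] (u i * u i) ≡ M * W
  2∑u²≡M*W = begin
    + 2 * ∑[ i < m ] (u i * u i)
      ≡⟨ cong (+ 2 *_) (sum-cong-≗ (λ i → expand M (fℤ i) F)) ⟩
    + 2 * ∑[ i < m ] (M * M * (fℤ i * fℤ i) + F * F - + 2 * (M * F * fℤ i))
      ≡⟨ cong (+ 2 *_) (∑-distrib-+-2* m (λ i → M * M * (fℤ i * fℤ i)) (λ _ → F * F) (λ i → M * F * fℤ i)) ⟩
    + 2 * (∑[ i < m ] (M * M * (fℤ i * fℤ i)) + ∑[ i < m ] (F * F) - + 2 * ∑[ i < m ] (M * F * fℤ i))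
      ≡⟨ cong₂ (λ a b → + 2 * (a - + 2 * b)) (cong₂ _+_ (∑-*ˡ m (M * M) (λ i → fℤ i * fℤ i)) (∑-const m (F * F)))
                                             (∑-*ˡ m (M * F) fℤ) ⟩
    + 2 * (M * M * Q + M * (F * F) - + 2 * (M * F * F))
      ≡⟨ collect M Q F ⟩
    M * (+ 2 * (M * Q - F * F))
      ≡⟨ cong (M *_) W≡2[MQ-F²] ⟨
    M * W ∎
    where
    open ≡-Reasoning
    expand : ∀ m a f → (m * a - f) * (m * a - f) ≡ m * m * (a * a) + f * f - + 2 * (m * f * a)
    expand = solve-∀
    collect : ∀ m q f → + 2 * (m * m * q + m * (f * f) - + 2 * (m * f * f)) ≡ m * (+ 2 * (m * q - f * f))
    collect = solve-∀

  M*G²≤2WT : 0 ℕ.< m → M * (G * G) ≤ + 2 * W * T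
  M*G²≤2WT 0<m = *-cancelˡ-≤-0< (ℤ.+<+ 0<m) (begin
    M * (M * (G * G))                     ≡⟨ cong (λ g → M * (M * (g * g))) G≡2∑t*f ⟩
    M * (M * (+ 2 * A * (+ 2 * A)))       ≡⟨ regroup M A ⟩
    + 4 * ((M * A) * (M * A))             ≡⟨ cong (λ x → + 4 * (x * x)) ∑u*t≡M*∑t*f ⟨
    + 4 * (U * U)                         ≤⟨ *-monoˡ-≤-0≤ {+ 4} (ℤ.+≤+ z≤n) (cauchy-schwarz m u t) ⟩
    + 4 * (∑[ i < m ] (u i * u i) * T)    ≡⟨ regroup′ (∑[ i < m ] (u i * u i)) T ⟩
    + 2 * (+ 2 * ∑[ i < m ] (u i * u i)) * T ≡⟨ cong (λ x → + 2 * x * T) 2∑u²≡M*W ⟩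
    + 2 * (M * W) * T                     ≡⟨ regroup″ M W T ⟩
    M * (+ 2 * W * T)                     ∎)
    where
    open ℤ.≤-Reasoning
    A = ∑[ i < m ] (t i * fℤ i)
    U = ∑[ i < m ] (u i * t i)
    regroup : ∀ m a → m * (m * (+ 2 * a * (+ 2 * a))) ≡ + 4 * ((m * a) * (m * a))
    regroup = solve-∀
    regroup′ : ∀ a b → + 4 * (a * b) ≡ + 2 * (+ 2 * a) * b
    regroup′ = solve-∀
    regroup″ : ∀ m w t → + 2 * (m * w) * t ≡ m * (+ 2 * w * t)
    regroup″ = solve-∀

  c : Fin m → ℤ
  c i = ∑[ j < m ] [ f i ≟ f j ]

  private
    ∑³ : (Fin m → Fin m → Fin m → ℤ) → ℤ
    ∑³ h = ∑[ i < m ] ∑[ j < m ] ∑[ l < m ] h i j l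

    ∑³-distrib-+ : ∀ h h′ → ∑³ (λ i j l → h i j l + h′ i j l) ≡ ∑³ h + ∑³ h′
    ∑³-distrib-+ h h′ =
      trans (sum-cong-≗ (λ i → trans (sum-cong-≗ (λ j → ∑-distrib-+ (h i j) (h′ i j)))
                                     (∑-distrib-+ (λ j → sum (h i j)) (λ j → sum (h′ i j)))))
            (∑-distrib-+ (λ i → ∑[ j < m ] sum (h i j)) (λ i → ∑[ j < m ] sum (h′ i j)))

    ∑³-triple≡3T+∑c² : ∑³ (λ i j l → triple (f i) (f j) (f l)) ≡ + 3 * T + ∑[ i < m ] (c i * c i)
    ∑³-triple≡3T+∑c² = begin
      ∑³ (λ i j l → h₁ i j l + h₂ i j l + h₃ i j l + h₄ i j l)
        ≡⟨ trans (∑³-distrib-+ (λ i j l → h₁ i j l + h₂ i j l + h₃ i j l) h₄)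
                 (cong (_+ ∑³ h₄) (trans (∑³-distrib-+ (λ i j l → h₁ i j l + h₂ i j l) h₃)
                                         (cong (_+ ∑³ h₃) (∑³-distrib-+ h₁ h₂)))) ⟩
      ∑³ h₁ + ∑³ h₂ + ∑³ h₃ + ∑³ h₄
        ≡⟨ cong₂ _+_ (cong₂ _+_ (cong₂ _+_ ∑³h₁≡T ∑³h₂≡T) ∑³h₃≡T) ∑³h₄≡∑c² ⟩
      T + T + T + ∑[ i < m ] (c i * c i)
        ≡⟨ cong (_+ ∑[ i < m ] (c i * c i)) (thrice T) ⟨
      + 3 * T + ∑[ i < m ] (c i * c i) ∎
      where
      open ≡-Reasoning
      e : Fin m → Fin m → ℤ
      e i j = [ f i ≟ f j ]
      h₁ h₂ h₃ h₄ : Fin m → Fin m → Fin m → ℤ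
      h₁ i j l = s i j * s i l
      h₂ i j l = s j i * s j l
      h₃ i j l = s l i * s l j
      h₄ i j l = e i j * e i l
      ∑³h₁≡T : ∑³ h₁ ≡ T
      ∑³h₁≡T = sum-cong-≗ (λ i → ∑-product m m (s i) (s i))
      ∑³h₂≡T : ∑³ h₂ ≡ T
      ∑³h₂≡T = trans (∑-comm (λ i j → ∑[ l < m ] h₂ i j l)) ∑³h₁≡T
      ∑³h₃≡T : ∑³ h₃ ≡ T
      ∑³h₃≡T = trans (sum-cong-≗ (λ i → ∑-comm (h₃ i))) (trans (∑-comm (λ i l → ∑[ j < m ] h₃ i j l)) ∑³h₁≡T)
      ∑³h₄≡∑c² : ∑³ h₄ ≡ ∑[ i < m ] (c i * c i)
      ∑³h₄≡∑c² = sum-cong-≗ (λ i → ∑-product m m (e i) (e i))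
      thrice : ∀ a → + 3 * a ≡ a + a + a
      thrice = solve-∀

    ∑³-triple≡M³ : ∑³ (λ i j l → triple (f i) (f j) (f l)) ≡ M * M * M
    ∑³-triple≡M³ = begin
      ∑³ (λ i j l → triple (f i) (f j) (f l))
        ≡⟨ sum-cong-≗ (λ i → sum-cong-≗ (λ j → trans (sum-cong-≗ (λ l → triple≡1 (f i) (f j) (f l))) (∑-const m 1ℤ))) ⟩
      ∑[ i < m ] ∑[ j < m ] (M * 1ℤ)
        ≡⟨ sum-cong-≗ {m} {x = λ _ → ∑[ j < m ] (M * 1ℤ)} {y = λ _ → M * (M * 1ℤ)} (λ _ → ∑-const m (M * 1ℤ)) ⟩
      ∑[ i < m ] (M * (M * 1ℤ))
        ≡⟨ ∑-const m (M * (M * 1ℤ)) ⟩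
      M * (M * (M * 1ℤ))
        ≡⟨ cube M ⟩
      M * M * M ∎
      where
      open ≡-Reasoning
      cube : ∀ a → a * (a * (a * 1ℤ)) ≡ a * a * a
      cube = solve-∀

  3T+∑c²≡M³ : + 3 * T + ∑[ i < m ] (c i * c i) ≡ M * M * M
  3T+∑c²≡M³ = trans (sym ∑³-triple≡3T+∑c²) ∑³-triple≡M³

module FibreBound {m k : ℕ} (f : Fin m → ℕ) (φ : Fin m → Fin k) (φ-fibres : ∀ i j → φ i ≡ φ j → f i ≡ f j) where

  open import Data.Nat as ℕ using (z≤n; s≤s)
  import Data.Nat.Properties as ℕ
  open import Data.Nat.Properties using (_≟_)
  open import Data.Fin as Fin using ()
  import Data.Fin.Properties as Fin
  open import Data.Integer as ℤ using (ℤ; +_; _+_; _*_; _-_; 0ℤ; 1ℤ; _≤_; _<_)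
  import Data.Integer.Properties as ℤ
  open import Data.Integer.Tactic.RingSolver using (solve-∀)
  open import Relation.Binary.PropositionalEquality using (sym; cong; cong₂; module ≡-Reasoning)
  open import Relation.Nullary using (yes; no)
  open import Function using (_∘′_)
  open IntegerOrder
  open Iverson
  open Summation
  open Dispersion f

  K : ℤ
  K = + k

  fibre : Fin k → ℤ
  fibre p = ∑[ i < m ] [ φ i Fin.≟ p ]

  ∑∘φ : ∀ (g : Fin k → ℤ) → ∑[ i < m ] g (φ i) ≡ ∑[ p < k ] (fibre p * g p)
  ∑∘φ g = begin
    ∑[ i < m ] g (φ i)                            ≡⟨ sum-cong-≗ (λ i → ∑-[≟]-* k (φ i) g) ⟨
    ∑[ i < m ] ∑[ p < k ] ([ φ i Fin.≟ p ] * g p) ≡⟨ ∑-comm (λ i p → [ φ i Fin.≟ p ] * g p) ⟩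
    ∑[ p < k ] ∑[ i < m ] ([ φ i Fin.≟ p ] * g p) ≡⟨ sum-cong-≗ (λ p → ∑-*ʳ m (g p) (λ i → [ φ i Fin.≟ p ])) ⟩
    ∑[ p < k ] (fibre p * g p)                    ∎
    where open ≡-Reasoning

  ∑fibre≡M : sum fibre ≡ M
  ∑fibre≡M = begin
    sum fibre                   ≡⟨ sum-cong-≗ (λ p → ℤ.*-identityʳ (fibre p)) ⟨
    ∑[ p < k ] (fibre p * 1ℤ)   ≡⟨ ∑∘φ (λ _ → 1ℤ) ⟨
    ∑[ i < m ] 1ℤ               ≡⟨ ∑-const m 1ℤ ⟩
    M * 1ℤ                      ≡⟨ ℤ.*-identityʳ M ⟩
    M                           ∎
    where open ≡-Reasoning

  0≤fibre : ∀ p → 0ℤ ≤ fibre p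
  0≤fibre p = ∑-nonNeg m (λ i → ℤ.+≤+ z≤n)

  fibre∘φ≤c : ∀ i → fibre (φ i) ≤ c i
  fibre∘φ≤c i = ∑-mono-≤ m bracket≤
    where
    bracket≤ : ∀ j → [ φ j Fin.≟ φ i ] ≤ [ f i ≟ f j ]
    bracket≤ j with φ j Fin.≟ φ i
    ... | yes φj≡φi = ℤ.≤-reflexive (sym ([yes] (φ-fibres i j (sym φj≡φi))))
    ... | no _      = ℤ.+≤+ z≤n

  M³≤K²∑c² : M * M * M ≤ K * K * ∑[ i < m ] (c i * c i)
  M³≤K²∑c² = begin
    M * M * M                                              ≡⟨ cong (λ z → z * z * z) ∑fibre≡M ⟨
    sum fibre * sum fibre * sum fibre                      ≤⟨ power-mean-cube k fibre 0≤fibre ⟩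
    K * K * ∑[ p < k ] (fibre p * (fibre p * fibre p))     ≡⟨ cong (K * K *_) (∑∘φ (λ p → fibre p * fibre p)) ⟨
    K * K * ∑[ i < m ] (fibre (φ i) * fibre (φ i))         ≤⟨ *-monoˡ-≤-0≤ (0≤i*i K) (∑-mono-≤ m fibre²≤c²) ⟩
    K * K * ∑[ i < m ] (c i * c i)                         ∎
    where
    open ℤ.≤-Reasoning
    fibre²≤c² : ∀ i → fibre (φ i) * fibre (φ i) ≤ c i * c i
    fibre²≤c² i = *-self-mono-≤ (0≤fibre (φ i)) (fibre∘φ≤c i)

  3K²T≤[K²-1]M³ : + 3 * (K * K) * T ≤ (K * K - 1ℤ) * (M * M * M)
  3K²T≤[K²-1]M³ = begin
    + 3 * (K * K) * T                      ≡⟨ split K T C ⟩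
    K * K * (+ 3 * T + C) - K * K * C      ≡⟨ cong (λ z → K * K * z - K * K * C) 3T+∑c²≡M³ ⟩
    K * K * (M * M * M) - K * K * C        ≤⟨ ℤ.+-monoʳ-≤ (K * K * (M * M * M)) (ℤ.neg-mono-≤ M³≤K²∑c²) ⟩
    K * K * (M * M * M) - M * M * M        ≡⟨ collect K (M * M * M) ⟩
    (K * K - 1ℤ) * (M * M * M)             ∎
    where
    open ℤ.≤-Reasoning
    C = ∑[ i < m ] (c i * c i)
    split : ∀ k t c → + 3 * (k * k) * t ≡ k * k * (+ 3 * t + c) - k * k * c
    split = solve-∀
    collect : ∀ k x → k * k * x - x ≡ (k * k - 1ℤ) * x
    collect = solve-∀

  0≤W : 0ℤ ≤ W
  0≤W = ∑-nonNeg m (λ i → ∑-nonNeg m (λ j → 0≤i*i (fℤ i - fℤ j)))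

  3K²G²≤2[K²-1]M²W : 0 ℕ.< m → + 3 * (K * K) * (G * G) ≤ + 2 * (K * K - 1ℤ) * (M * M) * W
  3K²G²≤2[K²-1]M²W 0<m = *-cancelˡ-≤-0< (ℤ.+<+ 0<m) (begin
    M * (+ 3 * (K * K) * (G * G))          ≡⟨ regroup₁ M K G ⟩
    + 3 * (K * K) * (M * (G * G))          ≤⟨ *-monoˡ-≤-0≤ (*-0≤ {+ 3} (ℤ.+≤+ z≤n) (0≤i*i K)) (M*G²≤2WT 0<m) ⟩
    + 3 * (K * K) * (+ 2 * W * T)          ≡⟨ regroup₂ K W T ⟩
    + 2 * W * (+ 3 * (K * K) * T)          ≤⟨ *-monoˡ-≤-0≤ (*-0≤ {+ 2} (ℤ.+≤+ z≤n) 0≤W) 3K²T≤[K²-1]M³ ⟩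
    + 2 * W * ((K * K - 1ℤ) * (M * M * M)) ≡⟨ regroup₃ W K M ⟩
    M * (+ 2 * (K * K - 1ℤ) * (M * M) * W) ∎)
    where
    open ℤ.≤-Reasoning
    regroup₁ : ∀ m k g → m * (+ 3 * (k * k) * (g * g)) ≡ + 3 * (k * k) * (m * (g * g))
    regroup₁ = solve-∀
    regroup₂ : ∀ k w t → + 3 * (k * k) * (+ 2 * w * t) ≡ + 2 * w * (+ 3 * (k * k) * t)
    regroup₂ = solve-∀
    regroup₃ : ∀ w k m → + 2 * w * ((k * k - 1ℤ) * (m * m * m)) ≡ m * (+ 2 * (k * k - 1ℤ) * (m * m) * w)
    regroup₃ = solve-∀

  1≤K² : 0 ℕ.< m → 1ℤ ≤ K * K
  1≤K² 0<m = ℤ.≤-trans (ℤ.+≤+ (ℕ.*-mono-≤ 0<k 0<k)) (ℤ.≤-reflexive (ℤ.pos-* k k))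
    where
    0<k : 0 ℕ.< k
    0<k = ℕ.≤-<-trans z≤n (Fin.toℕ<n (φ (Fin.fromℕ< 0<m)))

  W≡0⇒G≡0 : 0 ℕ.< m → W ≡ 0ℤ → G ≡ 0ℤ
  W≡0⇒G≡0 0<m W≡0 = i*i≤0⇒i≡0 G (*-cancelˡ-≤-0< 0<3K² (begin
    + 3 * (K * K) * (G * G)                ≤⟨ 3K²G²≤2[K²-1]M²W 0<m ⟩
    + 2 * (K * K - 1ℤ) * (M * M) * W       ≡⟨ cong (+ 2 * (K * K - 1ℤ) * (M * M) *_) W≡0 ⟩
    + 2 * (K * K - 1ℤ) * (M * M) * 0ℤ      ≡⟨ annihilate K M ⟩
    + 3 * (K * K) * 0ℤ                     ∎))
    where
    open ℤ.≤-Reasoning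
    0<3K² : 0ℤ < + 3 * (K * K)
    0<3K² = ℤ.*-monoˡ-<-pos (+ 3) (ℤ.<-≤-trans (ℤ.+<+ (s≤s z≤n)) (1≤K² 0<m))
    annihilate : ∀ k m → + 2 * (k * k - 1ℤ) * (m * m) * 0ℤ ≡ + 3 * (k * k) * 0ℤ
    annihilate = solve-∀

  6K²[NG-W]≤[K²-1]M²N² : 0 ℕ.< m → ∀ N → + 6 * (K * K) * (N * G - W) ≤ (K * K - 1ℤ) * (M * M) * (N * N)
  6K²[NG-W]≤[K²-1]M²N² 0<m N with W ℤ.≟ 0ℤ
  ... | yes W≡0 = begin
    + 6 * (K * K) * (N * G - W)        ≡⟨ cong₂ (λ g w → + 6 * (K * K) * (N * g - w)) (W≡0⇒G≡0 0<m W≡0) W≡0 ⟩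
    + 6 * (K * K) * (N * 0ℤ - 0ℤ)      ≡⟨ vanish K N ⟩
    0ℤ                                 ≤⟨ *-0≤ (*-0≤ (ℤ.i≤j⇒0≤j-i (1≤K² 0<m)) (0≤i*i M)) (0≤i*i N) ⟩
    (K * K - 1ℤ) * (M * M) * (N * N)   ∎
    where
    open ℤ.≤-Reasoning
    vanish : ∀ k n → + 6 * (k * k) * (n * 0ℤ - 0ℤ) ≡ 0ℤ
    vanish = solve-∀
  ... | no  W≢0 = *-cancelˡ-≤-0< 0<2W (begin
    + 2 * W * (+ 6 * (K * K) * (N * G - W))        ≡⟨ regroup₁ W K N G ⟩
    + 3 * (K * K) * (+ 4 * W * (N * G - W))        ≤⟨ *-monoˡ-≤-0≤ (*-0≤ {+ 3} (ℤ.+≤+ z≤n) (0≤i*i K)) (am-gm (N * G) W) ⟩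
    + 3 * (K * K) * ((N * G) * (N * G))            ≡⟨ regroup₂ K N G ⟩
    N * N * (+ 3 * (K * K) * (G * G))              ≤⟨ *-monoˡ-≤-0≤ (0≤i*i N) (3K²G²≤2[K²-1]M²W 0<m) ⟩
    N * N * (+ 2 * (K * K - 1ℤ) * (M * M) * W)     ≡⟨ regroup₃ N K M W ⟩
    + 2 * W * ((K * K - 1ℤ) * (M * M) * (N * N))   ∎)
    where
    open ℤ.≤-Reasoning
    0<2W : 0ℤ < + 2 * W
    0<2W = ℤ.*-monoˡ-<-pos (+ 2) (ℤ.≤∧≢⇒< 0≤W (W≢0 ∘′ sym))
    regroup₁ : ∀ w k n g → + 2 * w * (+ 6 * (k * k) * (n * g - w)) ≡ + 3 * (k * k) * (+ 4 * w * (n * g - w))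
    regroup₁ = solve-∀
    regroup₂ : ∀ k n g → + 3 * (k * k) * ((n * g) * (n * g)) ≡ n * n * (+ 3 * (k * k) * (g * g))
    regroup₂ = solve-∀
    regroup₃ : ∀ n k m w → n * n * (+ 2 * (k * k - 1ℤ) * (m * m) * w) ≡ + 2 * w * ((k * k - 1ℤ) * (m * m) * (n * n))
    regroup₃ = solve-∀

module CrossingIdentity {m n p : ℕ} (D : Drawing m n p) where

  open import Data.Nat as ℕ using ()
  import Data.Nat.Properties as ℕ
  open import Data.Nat.Properties using (_<?_; _≟_)
  open import Data.Fin as Fin using (toℕ)
  import Data.Fin.Properties as Fin
  open import Data.Integer as ℤ using (ℤ; +_; _+_; _*_; _-_; 1ℤ; _≤_)
  import Data.Integer.Properties as ℤ
  open import Data.Integer.Tactic.RingSolver using (solve-∀)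
  open import Data.Sum using (inj₁; inj₂)
  open import Relation.Binary.PropositionalEquality
    using (_≢_; refl; sym; trans; cong; cong₂; subst₂; module ≡-Reasoning)
  open Iverson
  open Summation
  open Comparisons
  open OrderIdentities

  M N : ℤ
  M = + m
  N = + n

  P : Fin m → ℕ
  P i = toℕ (pos D (inj₁ i))

  Q : Fin n → ℕ
  Q j = toℕ (pos D (inj₂ j))

  P-injective : ∀ {i i′} → P i ≡ P i′ → i ≡ i′
  P-injective Pi≡Pi′ with pos-inj D (Fin.toℕ-injective Pi≡Pi′)
  ... | refl = refl

  Q-injective : ∀ {j j′} → Q j ≡ Q j′ → j ≡ j′
  Q-injective Qj≡Qj′ with pos-inj D (Fin.toℕ-injective Qj≡Qj′)
  ... | refl = refl

  P≢Q : ∀ {i j} → P i ≢ Q j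
  P≢Q Pi≡Qj with pos-inj D (Fin.toℕ-injective Pi≡Qj)
  ... | ()

  ∑⁴ : (Fin m → Fin n → Fin m → Fin n → ℤ) → ℤ
  ∑⁴ H = ∑[ i < m ] ∑[ j < n ] ∑[ i′ < m ] ∑[ j′ < n ] H i j i′ j′

  private
    ∑⁴-cong : ∀ {H H′} → (∀ i j i′ j′ → H i j i′ j′ ≡ H′ i j i′ j′) → ∑⁴ H ≡ ∑⁴ H′
    ∑⁴-cong H≡H′ = sum-cong-≗ (λ i → sum-cong-≗ (λ j → sum-cong-≗ (λ i′ → sum-cong-≗ (H≡H′ i j i′))))

    ∑⁴-distrib-+ : ∀ H H′ → ∑⁴ (λ i j i′ j′ → H i j i′ j′ + H′ i j i′ j′) ≡ ∑⁴ H + ∑⁴ H′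
    ∑⁴-distrib-+ H H′ =
      trans (sum-cong-≗ (λ i → trans (sum-cong-≗ (λ j → trans (sum-cong-≗ (λ i′ → ∑-distrib-+ (H i j i′) (H′ i j i′)))
                                                              (∑-distrib-+ (λ i′ → sum (H i j i′)) (λ i′ → sum (H′ i j i′)))))
                                     (∑-distrib-+ (λ j → ∑[ i′ < m ] sum (H i j i′)) (λ j → ∑[ i′ < m ] sum (H′ i j i′)))))
            (∑-distrib-+ (λ i → ∑[ j < n ] ∑[ i′ < m ] sum (H i j i′)) (λ i → ∑[ j < n ] ∑[ i′ < m ] sum (H′ i j i′)))

    ∑⁴-by-pairs : ∀ H → ∑⁴ H ≡ ∑[ i < m ] ∑[ i′ < m ] ∑[ j < n ] ∑[ j′ < n ] H i j i′ j′
    ∑⁴-by-pairs H = sum-cong-≗ (λ i → ∑-comm (λ j i′ → ∑[ j′ < n ] H i j i′ j′))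

    ∑⁴-swapᵢ : ∀ H → ∑⁴ (λ i j i′ j′ → H i′ j i j′) ≡ ∑⁴ H
    ∑⁴-swapᵢ H = begin
      ∑⁴ (λ i j i′ j′ → H i′ j i j′)                              ≡⟨ ∑⁴-by-pairs (λ i j i′ j′ → H i′ j i j′) ⟩
      ∑[ i < m ] ∑[ i′ < m ] ∑[ j < n ] ∑[ j′ < n ] H i′ j i j′
        ≡⟨ ∑-comm (λ i i′ → ∑[ j < n ] ∑[ j′ < n ] H i′ j i j′) ⟩
      ∑[ i′ < m ] ∑[ i < m ] ∑[ j < n ] ∑[ j′ < n ] H i′ j i j′    ≡⟨ ∑⁴-by-pairs H ⟨
      ∑⁴ H                                                        ∎
      where open ≡-Reasoning

    ∑⁴-swapⱼ : ∀ H → ∑⁴ (λ i j i′ j′ → H i j′ i′ j) ≡ ∑⁴ H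
    ∑⁴-swapⱼ H = begin
      ∑⁴ (λ i j i′ j′ → H i j′ i′ j)                              ≡⟨ ∑⁴-by-pairs (λ i j i′ j′ → H i j′ i′ j) ⟩
      ∑[ i < m ] ∑[ i′ < m ] ∑[ j < n ] ∑[ j′ < n ] H i j′ i′ j
        ≡⟨ sum-cong-≗ (λ i → sum-cong-≗ (λ i′ → ∑-comm (λ j j′ → H i j′ i′ j))) ⟩
      ∑[ i < m ] ∑[ i′ < m ] ∑[ j′ < n ] ∑[ j < n ] H i j′ i′ j    ≡⟨ ∑⁴-by-pairs H ⟨
      ∑⁴ H                                                        ∎
      where open ≡-Reasoning

  crossing : Fin m → Fin n → Fin m → Fin n → ℤ
  crossing i j i′ j′ = [ interleave? (P i) (Q j) (P i′) (Q j′) ]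

  Cr : ℤ
  Cr = ∑⁴ crossing

  +crossings≡Cr : + crossings D ≡ Cr
  +crossings≡Cr =
    trans (+-sumFin m (λ i → sumFin n λ j → sumFin m λ i′ → sumFin n (c i j i′)))
          (sum-cong-≗ (λ i → trans (+-sumFin n (λ j → sumFin m λ i′ → sumFin n (c i j i′)))
                                   (sum-cong-≗ (λ j → trans (+-sumFin m (λ i′ → sumFin n (c i j i′)))
                                                            (sum-cong-≗ (λ i′ → +-sumFin n (c i j i′)))))))
    where
    c : Fin m → Fin n → Fin m → Fin n → ℕ
    c i j i′ j′ = indicator (crosses? D i j i′ j′)

  below : Fin m → Fin n → ℤ
  below i j = [ Q j <? P i ]

  f : Fin m → ℕ
  f i = sumFin n (λ j → indicator (Q j <? P i))

  +f≡∑below : ∀ i → + f i ≡ ∑[ j < n ] below i j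
  +f≡∑below i = +-sumFin n (λ j → indicator (Q j <? P i))

  s : Fin m → Fin m → ℤ
  s i i′ = ∑[ j < n ] between (P i) (Q j) (P i′)

  Z : ℤ
  Z = ∑[ i < m ] ∑[ i′ < m ] (s i i′ * (N - s i i′))

  ∑⁴crossingPairings≡4Cr+2Z : ∑⁴ (λ i j i′ j′ → crossingPairings (P i) (Q j) (P i′) (Q j′)) ≡ + 4 * Cr + + 2 * Z
  ∑⁴crossingPairings≡4Cr+2Z = begin
    ∑⁴ (λ i j i′ j′ → k₁ i j i′ j′ + k₂ i j i′ j′ + (k₃ i j i′ j′ + k₄ i j i′ j′) + X i j i′ j′)
      ≡⟨ trans (∑⁴-distrib-+ (λ i j i′ j′ → k₁ i j i′ j′ + k₂ i j i′ j′ + (k₃ i j i′ j′ + k₄ i j i′ j′)) X)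
               (cong (_+ ∑⁴ X) (trans (∑⁴-distrib-+ (λ i j i′ j′ → k₁ i j i′ j′ + k₂ i j i′ j′)
                                                    (λ i j i′ j′ → k₃ i j i′ j′ + k₄ i j i′ j′))
                                      (cong₂ _+_ (∑⁴-distrib-+ k₁ k₂) (∑⁴-distrib-+ k₃ k₄)))) ⟩
    (∑⁴ k₁ + ∑⁴ k₂) + (∑⁴ k₃ + ∑⁴ k₄) + ∑⁴ X
      ≡⟨ cong₂ _+_ (cong₂ _+_ (cong (_+_ Cr) ∑⁴k₂≡Cr) (cong₂ _+_ (∑⁴-swapⱼ crossing) (∑⁴-swapᵢ crossing))) ∑⁴X≡2Z ⟩
    (Cr + Cr) + (Cr + Cr) + + 2 * Z
      ≡⟨ collect Cr Z ⟩
    + 4 * Cr + + 2 * Z ∎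
    where
    open ≡-Reasoning
    k₁ k₂ k₃ k₄ X : Fin m → Fin n → Fin m → Fin n → ℤ
    k₁ = crossing
    k₂ i j i′ j′ = crossing i′ j′ i j
    k₃ i j i′ j′ = crossing i j′ i′ j
    k₄ i j i′ j′ = crossing i′ j i j′
    X i j i′ j′ = xor (between (P i) (Q j) (P i′)) (between (P i) (Q j′) (P i′))
    ∑⁴k₂≡Cr : ∑⁴ k₂ ≡ Cr
    ∑⁴k₂≡Cr = trans (∑⁴-swapᵢ (λ i j i′ j′ → crossing i j′ i′ j)) (∑⁴-swapⱼ crossing)
    ∑∑xor : ∀ i i′ → ∑[ j < n ] ∑[ j′ < n ] X i j i′ j′ ≡ + 2 * (s i i′ * (N - s i i′))
    ∑∑xor i i′ = begin
      ∑[ j < n ] ∑[ j′ < n ] xor (b j) (b j′)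
        ≡⟨ sum-cong-≗ (λ j → ∑-distrib-+-2* n (λ _ → b j) b (λ j′ → b j * b j′)) ⟩
      ∑[ j < n ] (∑[ j′ < n ] b j + s i i′ - + 2 * ∑[ j′ < n ] (b j * b j′))
        ≡⟨ ∑-distrib-+-2* n (λ j → ∑[ j′ < n ] b j) (λ _ → s i i′) (λ j → ∑[ j′ < n ] (b j * b j′)) ⟩
      ∑[ j < n ] ∑[ j′ < n ] b j + ∑[ j < n ] s i i′ - + 2 * ∑[ j < n ] ∑[ j′ < n ] (b j * b j′)
        ≡⟨ cong₂ (λ x y → x - + 2 * y)
                 (cong₂ _+_ (trans (sum-cong-≗ (λ j → ∑-const n (b j))) (∑-*ˡ n N b)) (∑-const n (s i i′)))
                 (∑-product n n b b) ⟩
      N * s i i′ + N * s i i′ - + 2 * (s i i′ * s i i′)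
        ≡⟨ collect′ N (s i i′) ⟩
      + 2 * (s i i′ * (N - s i i′)) ∎
      where
      b : Fin n → ℤ
      b j = between (P i) (Q j) (P i′)
      collect′ : ∀ n s → n * s + n * s - + 2 * (s * s) ≡ + 2 * (s * (n - s))
      collect′ = solve-∀
    ∑⁴X≡2Z : ∑⁴ X ≡ + 2 * Z
    ∑⁴X≡2Z = trans (∑⁴-by-pairs X)
               (trans (sum-cong-≗ (λ i → trans (sum-cong-≗ (∑∑xor i)) (∑-*ˡ m (+ 2) (λ i′ → s i i′ * (N - s i i′)))))
                      (∑-*ˡ m (+ 2) (λ i → ∑[ i′ < m ] (s i i′ * (N - s i i′)))))
    collect : ∀ c z → (c + c) + (c + c) + + 2 * z ≡ + 4 * c + + 2 * z
    collect = solve-∀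

  ∑⁴crossingPairings≡[M²-M][N²-N] :
    ∑⁴ (λ i j i′ j′ → crossingPairings (P i) (Q j) (P i′) (Q j′)) ≡ (M * M - M) * (N * N - N)
  ∑⁴crossingPairings≡[M²-M][N²-N] = begin
    ∑⁴ (λ i j i′ j′ → crossingPairings (P i) (Q j) (P i′) (Q j′))
      ≡⟨ ∑⁴-cong (λ i j i′ j′ → one-crossing-pairing P≢Q P≢Q P≢Q P≢Q) ⟩
    ∑⁴ (λ i j i′ j′ → α i i′ * β j j′)
      ≡⟨ ∑⁴-by-pairs (λ i j i′ j′ → α i i′ * β j j′) ⟩
    ∑[ i < m ] ∑[ i′ < m ] ∑[ j < n ] ∑[ j′ < n ] (α i i′ * β j j′)
      ≡⟨ sum-cong-≗ (λ i → sum-cong-≗ (λ i′ → trans (sum-cong-≗ (λ j → ∑-*ˡ n (α i i′) (β j)))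
                                                    (∑-*ˡ n (α i i′) (λ j → sum (β j))))) ⟩
    ∑[ i < m ] ∑[ i′ < m ] (α i i′ * B)
      ≡⟨ trans (sum-cong-≗ (λ i → ∑-*ʳ m B (α i))) (∑-*ʳ m B (λ i → sum (α i))) ⟩
    ∑[ i < m ] ∑[ i′ < m ] α i i′ * B
      ≡⟨ cong₂ _*_ (trans (sum-cong-≗ (λ i → sum-cong-≗ (λ i′ → cong (1ℤ -_) ([P≟P] i i′)))) (∑-[≢] m))
                   (trans (sum-cong-≗ (λ j → sum-cong-≗ (λ j′ → cong (1ℤ -_) ([Q≟Q] j j′)))) (∑-[≢] n)) ⟩
    (M * M - M) * (N * N - N) ∎
    where
    open ≡-Reasoning
    α : Fin m → Fin m → ℤ
    α i i′ = 1ℤ - [ P i ≟ P i′ ]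
    β : Fin n → Fin n → ℤ
    β j j′ = 1ℤ - [ Q j ≟ Q j′ ]
    B = ∑[ j < n ] ∑[ j′ < n ] β j j′
    [P≟P] : ∀ i i′ → [ P i ≟ P i′ ] ≡ [ i Fin.≟ i′ ]
    [P≟P] i i′ = bracket-⇔ (P i ≟ P i′) (i Fin.≟ i′) P-injective (cong P)
    [Q≟Q] : ∀ j j′ → [ Q j ≟ Q j′ ] ≡ [ j Fin.≟ j′ ]
    [Q≟Q] j j′ = bracket-⇔ (Q j ≟ Q j′) (j Fin.≟ j′) Q-injective (cong Q)

  4Cr+2Z≡[M²-M][N²-N] : + 4 * Cr + + 2 * Z ≡ (M * M - M) * (N * N - N)
  4Cr+2Z≡[M²-M][N²-N] = trans (sym ∑⁴crossingPairings≡4Cr+2Z) ∑⁴crossingPairings≡[M²-M][N²-N]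

  scaled-crossing-identity : ∀ K → + 3 * (K * K * (K * K)) * ((M * M - M) * (N * N - N))
                                   ≡ + 12 * (K * K * (K * K)) * + crossings D + K * K * (+ 6 * (K * K) * Z)
  scaled-crossing-identity K = begin
    + 3 * (K * K * (K * K)) * ((M * M - M) * (N * N - N))
      ≡⟨ cong (+ 3 * (K * K * (K * K)) *_) 4Cr+2Z≡[M²-M][N²-N] ⟨
    + 3 * (K * K * (K * K)) * (+ 4 * Cr + + 2 * Z)
      ≡⟨ distribute K Cr Z ⟩
    + 12 * (K * K * (K * K)) * Cr + K * K * (+ 6 * (K * K) * Z)
      ≡⟨ cong (λ c → + 12 * (K * K * (K * K)) * c + K * K * (+ 6 * (K * K) * Z)) +crossings≡Cr ⟨
    + 12 * (K * K * (K * K)) * + crossings D + K * K * (+ 6 * (K * K) * Z) ∎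
    where
    open ≡-Reasoning
    distribute : ∀ k c z → + 3 * (k * k * (k * k)) * (+ 4 * c + + 2 * z) ≡ + 12 * (k * k * (k * k)) * c + k * k * (+ 6 * (k * k) * z)
    distribute = solve-∀

  f≤f : ∀ {i i′} → P i ℕ.≤ P i′ → f i ℕ.≤ f i′
  f≤f {i} {i′} Pi≤Pi′ = ℤ.drop‿+≤+ (subst₂ _≤_ (sym (+f≡∑below i)) (sym (+f≡∑below i′))
    (∑-mono-≤ n (λ j → bracket-mono (Q j <? P i) (Q j <? P i′) (λ Qj<Pi → ℕ.<-≤-trans Qj<Pi Pi≤Pi′))))

  s≡f-f : ∀ {i i′} → P i ℕ.≤ P i′ → s i i′ ≡ + f i′ - + f i
  s≡f-f {i} {i′} Pi≤Pi′ = begin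
    s i i′                                ≡⟨ sum-cong-≗ (λ j → xor-→ (Q j <? P i) (Q j <? P i′) (λ Qj<Pi → ℕ.<-≤-trans Qj<Pi Pi≤Pi′)) ⟩
    ∑[ j < n ] (below i′ j - below i j)   ≡⟨ ∑-distrib-- n (below i′) (below i) ⟩
    sum (below i′) - sum (below i)        ≡⟨ cong₂ _-_ (+f≡∑below i′) (+f≡∑below i) ⟨
    + f i′ - + f i                        ∎
    where open ≡-Reasoning

  s≡dist : ∀ i i′ → s i i′ ≡ dist (f i) (f i′)
  s≡dist i i′ with ℕ.≤-total (P i) (P i′)
  ... | inj₁ Pi≤Pi′ = trans (s≡f-f Pi≤Pi′) (sym (dist-≤ (f≤f Pi≤Pi′)))
  ... | inj₂ Pi′≤Pi = begin
    s i i′              ≡⟨ sum-cong-≗ (λ j → xor-comm [ Q j <? P i ] [ Q j <? P i′ ]) ⟩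
    s i′ i              ≡⟨ s≡f-f Pi′≤Pi ⟩
    + f i - + f i′      ≡⟨ dist-≤ (f≤f Pi′≤Pi) ⟨
    dist (f i′) (f i)   ≡⟨ dist-sym (f i′) (f i) ⟩
    dist (f i) (f i′)   ∎
    where open ≡-Reasoning

  open Dispersion f using (G; W; fℤ)

  Z≡NG-W : Z ≡ N * G - W
  Z≡NG-W = begin
    Z
      ≡⟨ sum-cong-≗ (λ i → trans (sum-cong-≗ (summand i)) (∑-distrib-- m (λ i′ → N * d i i′) (sq i))) ⟩
    ∑[ i < m ] (∑[ i′ < m ] (N * d i i′) - sum (sq i))
      ≡⟨ ∑-distrib-- m (λ i → ∑[ i′ < m ] (N * d i i′)) (λ i → sum (sq i)) ⟩
    ∑[ i < m ] ∑[ i′ < m ] (N * d i i′) - W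
      ≡⟨ cong (_- W) (trans (sum-cong-≗ (λ i → ∑-*ˡ m N (d i))) (∑-*ˡ m N (λ i → sum (d i)))) ⟩
    N * G - W ∎
    where
    open ≡-Reasoning
    d sq : Fin m → Fin m → ℤ
    d i i′ = dist (f i) (f i′)
    sq i i′ = (fℤ i - fℤ i′) * (fℤ i - fℤ i′)
    summand : ∀ i i′ → s i i′ * (N - s i i′) ≡ N * d i i′ - sq i i′
    summand i i′ = trans (cong (λ x → x * (N - x)) (s≡dist i i′))
                         (trans (expand (d i i′) N) (cong (_-_ (N * d i i′)) (dist*dist (f i) (f i′))))
      where
      expand : ∀ d n → d * (n - d) ≡ n * d - d * d
      expand = solve-∀

module Halving where

  open import Data.Nat using (suc; _+_; _*_; _≤_; _<_; s≤s; s≤s⁻¹; _/_; _%_)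
  open import Data.Nat.Properties using (+-monoˡ-≤; <-cmp; <-irrefl; <-≤-trans; ≤-<-trans; module ≤-Reasoning)
  open import Data.Nat.DivMod using (m≡m%n+[m/n]*n; m%n<n; m/n*n≤m)
  open import Data.Empty using (⊥-elim)
  open import Relation.Binary using (tri<; tri≈; tri>)
  open import Relation.Binary.PropositionalEquality using (_≡_; _≢_; refl; cong)

  private
    /2-≡⇒≤suc : ∀ {a a′} → a / 2 ≡ a′ / 2 → a ≤ suc a′
    /2-≡⇒≤suc {a} {a′} a/2≡a′/2 = begin
      a                  ≡⟨ m≡m%n+[m/n]*n a 2 ⟩
      a % 2 + a / 2 * 2  ≤⟨ +-monoˡ-≤ (a / 2 * 2) (s≤s⁻¹ (m%n<n a 2)) ⟩
      1 + a / 2 * 2      ≡⟨ cong (λ h → 1 + h * 2) a/2≡a′/2 ⟩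
      1 + a′ / 2 * 2     ≤⟨ s≤s (m/n*n≤m a′ 2) ⟩
      suc a′             ∎
      where open ≤-Reasoning

  same-half-<-transfer : ∀ {a a′ b} → a / 2 ≡ a′ / 2 → b ≢ a′ → b < a → b < a′
  same-half-<-transfer {a} {a′} {b} a/2≡a′/2 b≢a′ b<a with <-cmp b a′
  ... | tri< b<a′ _ _ = b<a′
  ... | tri≈ _ b≡a′ _ = ⊥-elim (b≢a′ b≡a′)
  ... | tri> _ _ a′<b = ⊥-elim (<-irrefl refl (<-≤-trans (≤-<-trans a′<b b<a) (/2-≡⇒≤suc a/2≡a′/2)))

module LowerBound {m n k : ℕ} (D : Drawing m n (2 ℕ.* k)) where

  open import Data.Nat as ℕ using (_<_; _/_)
  import Data.Nat.Properties as ℕ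
  open import Data.Nat.Properties using (_<?_)
  open import Data.Nat.DivMod using (m<n*o⇒m/o<n)
  open import Data.Fin as Fin using (toℕ; fromℕ<)
  import Data.Fin.Properties as Fin
  open import Data.Integer as ℤ using (ℤ; +_; _+_; _*_; _-_; 1ℤ; _≤_)
  import Data.Integer.Properties as ℤ
  open import Data.Sum using (inj₁; inj₂)
  open import Data.Empty using (⊥-elim)
  open import Relation.Binary using (tri<; tri≈; tri>)
  open import Relation.Binary.PropositionalEquality using (_≢_; sym; trans; cong; subst; module ≡-Reasoning)
  open IntegerOrder
  open Iverson
  open Summation
  open CrossingIdentity D
  open Halving

  partℕ : Vertex m n → ℕ
  partℕ v = toℕ (part D v)

  parts-differ : ∀ i j → partℕ (inj₂ j) ≢ partℕ (inj₁ i)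
  parts-differ i j pj≡pi = independent D i j (sym (Fin.toℕ-injective pj≡pi))

  Q<P⇒part<part : ∀ {i j} → Q j < P i → partℕ (inj₂ j) < partℕ (inj₁ i)
  Q<P⇒part<part {i} {j} Qj<Pi with ℕ.<-cmp (partℕ (inj₂ j)) (partℕ (inj₁ i))
  ... | tri< pj<pi _ _ = pj<pi
  ... | tri≈ _ pj≡pi _ = ⊥-elim (parts-differ i j pj≡pi)
  ... | tri> _ _ pi<pj = ⊥-elim (ℕ.<-asym Qj<Pi (segments D (inj₁ i) (inj₂ j) pi<pj))

  φ : Fin m → Fin k
  φ i = fromℕ< (m<n*o⇒m/o<n (subst (partℕ (inj₁ i) <_) (ℕ.*-comm 2 k) (Fin.toℕ<n (part D (inj₁ i)))))

  -- Parts 2t and 2t + 1 are neighbouring arcs and a second-class vertex lies in neither of the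
  -- (independent) parts of two first-class vertices with φ-value t, so it precedes both or neither.
  φ-fibres : ∀ i i′ → φ i ≡ φ i′ → f i ≡ f i′
  φ-fibres i i′ φi≡φi′ = ℤ.+-injective (begin
    + f i                   ≡⟨ +f≡∑below i ⟩
    ∑[ j < n ] below i j    ≡⟨ sum-cong-≗ (λ j → bracket-⇔ (Q j <? P i) (Q j <? P i′) (transfer half≡ j) (transfer (sym half≡) j)) ⟩
    ∑[ j < n ] below i′ j   ≡⟨ +f≡∑below i′ ⟨
    + f i′                  ∎)
    where
    open ≡-Reasoning
    half≡ : partℕ (inj₁ i) / 2 ≡ partℕ (inj₁ i′) / 2
    half≡ = trans (sym (Fin.toℕ-fromℕ< _)) (trans (cong toℕ φi≡φi′) (Fin.toℕ-fromℕ< _))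
    transfer : ∀ {a a′} → partℕ (inj₁ a) / 2 ≡ partℕ (inj₁ a′) / 2 → ∀ j → Q j < P a → Q j < P a′
    transfer {a} {a′} eq j Qj<Pa =
      segments D (inj₂ j) (inj₁ a′) (same-half-<-transfer eq (parts-differ a′ j) (Q<P⇒part<part Qj<Pa))

  open FibreBound f φ φ-fibres using (K; 6K²[NG-W]≤[K²-1]M²N²)

  lower-boundℤ : 0 ℕ.< m →
    + 3 * (K * K * (K * K)) * ((M * M - M) * (N * N - N))
      ≤ + 12 * (K * K * (K * K)) * + crossings D + K * K * ((K * K - 1ℤ) * (M * M) * (N * N))
  lower-boundℤ 0<m = begin
    + 3 * (K * K * (K * K)) * ((M * M - M) * (N * N - N))
      ≡⟨ scaled-crossing-identity K ⟩
    + 12 * (K * K * (K * K)) * + crossings D + K * K * (+ 6 * (K * K) * Z)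
      ≤⟨ ℤ.+-monoʳ-≤ (+ 12 * (K * K * (K * K)) * + crossings D) (*-monoˡ-≤-0≤ (0≤i*i K) 6K²Z≤[K²-1]M²N²) ⟩
    + 12 * (K * K * (K * K)) * + crossings D + K * K * ((K * K - 1ℤ) * (M * M) * (N * N)) ∎
    where
    open ℤ.≤-Reasoning
    6K²Z≤[K²-1]M²N² : + 6 * (K * K) * Z ≤ (K * K - 1ℤ) * (M * M) * (N * N)
    6K²Z≤[K²-1]M²N² = subst (λ z → + 6 * (K * K) * z ≤ (K * K - 1ℤ) * (M * M) * (N * N)) (sym Z≡NG-W)
                            (6K²[NG-W]≤[K²-1]M²N² 0<m N)

module CombineOrder where

  open import Data.Nat as ℕ using (ℕ)
  import Data.Nat.Properties as ℕ
  open import Data.Fin using (Fin; toℕ; combine; _<_)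
  open import Data.Fin.Properties using (toℕ-combine; toℕ-injective; combine-monoˡ-<)
  open import Data.Product using (_×_; _,_)
  open import Data.Sum using (_⊎_; inj₁; inj₂)
  open import Data.Empty using (⊥-elim)
  open import Relation.Binary using (tri<; tri≈; tri>)
  open import Relation.Binary.PropositionalEquality using (_≡_; refl; sym; subst₂)

  combine-<-lex : ∀ {m n} {i i′ : Fin m} {j j′ : Fin n} → combine i j < combine i′ j′ → i < i′ ⊎ (i ≡ i′ × j < j′)
  combine-<-lex {n = n} {i} {i′} {j} {j′} ij<i′j′ with ℕ.<-cmp (toℕ i) (toℕ i′)
  ... | tri< i<i′ _ _  = inj₁ i<i′
  ... | tri> _ _ i′<i  = ⊥-elim (ℕ.<-asym ij<i′j′ (combine-monoˡ-< j′ j i′<i))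
  ... | tri≈ _ i≡i′ _ with toℕ-injective i≡i′
  ...   | refl = inj₂ (refl , ℕ.+-cancelˡ-< (n ℕ.* toℕ i) (toℕ j) (toℕ j′)
                                (subst₂ ℕ._<_ (toℕ-combine i j) (toℕ-combine i j′) ij<i′j′))

  lex-<-combine : ∀ {m n} {i i′ : Fin m} {j j′ : Fin n} → i < i′ ⊎ (i ≡ i′ × j < j′) → combine i j < combine i′ j′
  lex-<-combine {j = j} {j′} (inj₁ i<i′) = combine-monoˡ-< j j′ i<i′
  lex-<-combine {n = n} {i} {j = j} {j′} (inj₂ (refl , j<j′)) =
    subst₂ ℕ._<_ (sym (toℕ-combine i j)) (sym (toℕ-combine i j′)) (ℕ.+-monoʳ-< (n ℕ.* toℕ i) j<j′)

module RangeSums where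

  open import Data.Nat as ℕ using (ℕ; zero; suc; z≤n)
  open import Data.Nat.Properties using (_<?_)
  open import Data.Fin as Fin using (Fin; toℕ)
  open import Data.Integer as ℤ using (ℤ; +_; _+_; _*_; _-_; 0ℤ; 1ℤ)
  import Data.Integer.Properties as ℤ
  open import Data.Integer.Tactic.RingSolver using (solve-∀)
  open import Relation.Binary.PropositionalEquality using (_≡_; refl; trans; cong; cong₂; module ≡-Reasoning)
  open Iverson
  open Summation
  open Comparisons

  ι : ∀ {k} → Fin k → ℤ
  ι y = + toℕ y

  +suc : ∀ x → + suc x ≡ 1ℤ + + x
  +suc x = ℤ.pos-+ 1 x

  ∑[<] : ∀ k (y : Fin k) → ∑[ y′ < k ] [ toℕ y′ <? toℕ y ] ≡ ι y
  ∑[<] (suc k) Fin.zero    = begin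
    0ℤ + ∑[ y′ < k ] [ suc (toℕ y′) <? 0 ]   ≡⟨ ℤ.+-identityˡ _ ⟩
    ∑[ y′ < k ] [ suc (toℕ y′) <? 0 ]        ≡⟨ sum-cong-≗ {k} (λ y′ → [no] {d = suc (toℕ y′) <? 0} λ ()) ⟩
    ∑[ y′ < k ] 0ℤ                           ≡⟨ trans (∑-const k 0ℤ) (ℤ.*-zeroʳ (+ k)) ⟩
    0ℤ                                       ∎
    where open ≡-Reasoning
  ∑[<] (suc k) (Fin.suc y) = begin
    1ℤ + ∑[ y′ < k ] [ suc (toℕ y′) <? suc (toℕ y) ]
      ≡⟨ cong (_+_ 1ℤ) (sum-cong-≗ {k} (λ y′ → bracket-⇔ (suc (toℕ y′) <? suc (toℕ y)) (toℕ y′ <? toℕ y) ℕ.s<s⁻¹ ℕ.s<s)) ⟩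
    1ℤ + ∑[ y′ < k ] [ toℕ y′ <? toℕ y ]
      ≡⟨ cong (_+_ 1ℤ) (∑[<] k y) ⟩
    1ℤ + ι y
      ≡⟨ +suc (toℕ y) ⟨
    + suc (toℕ y) ∎
    where open ≡-Reasoning

  ∑-shift : ∀ k → ∑[ y < k ] (+ suc (toℕ y)) ≡ ∑[ y < k ] ι y + + k
  ∑-shift k = begin
    ∑[ y < k ] (+ suc (toℕ y))           ≡⟨ sum-cong-≗ {k} (λ y → trans (+suc (toℕ y)) (ℤ.+-comm 1ℤ (ι y))) ⟩
    ∑[ y < k ] (ι y + 1ℤ)                ≡⟨ ∑-distrib-+ (ι {k}) (λ _ → 1ℤ) ⟩
    ∑[ y < k ] ι y + ∑[ y < k ] 1ℤ       ≡⟨ cong (_+_ (sum (ι {k}))) (trans (∑-const k 1ℤ) (ℤ.*-identityʳ (+ k))) ⟩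
    ∑[ y < k ] ι y + + k                 ∎
    where open ≡-Reasoning

  2∑ι≡k²-k : ∀ k → + 2 * ∑[ y < k ] ι y ≡ + k * + k - + k
  2∑ι≡k²-k zero    = refl
  2∑ι≡k²-k (suc k) = begin
    + 2 * (0ℤ + ∑[ y < k ] (+ suc (toℕ y)))      ≡⟨ cong (λ z → + 2 * (0ℤ + z)) (∑-shift k) ⟩
    + 2 * (0ℤ + (∑[ y < k ] ι y + + k))          ≡⟨ step (∑[ y < k ] ι y) (+ k) ⟩
    + 2 * ∑[ y < k ] ι y + + 2 * + k             ≡⟨ cong (_+ + 2 * + k) (2∑ι≡k²-k k) ⟩
    + k * + k - + k + + 2 * + k                  ≡⟨ square (+ k) ⟩
    (1ℤ + + k) * (1ℤ + + k) - (1ℤ + + k)         ≡⟨ cong (λ z → z * z - z) (+suc k) ⟨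
    + suc k * + suc k - + suc k                  ∎
    where
    open ≡-Reasoning
    step : ∀ t k → + 2 * (0ℤ + (t + k)) ≡ + 2 * t + + 2 * k
    step = solve-∀
    square : ∀ k → k * k - k + + 2 * k ≡ (1ℤ + k) * (1ℤ + k) - (1ℤ + k)
    square = solve-∀

  ∑-shift² : ∀ k →
    ∑[ y < k ] (+ suc (toℕ y) * + suc (toℕ y)) ≡ ∑[ y < k ] (ι y * ι y) + + 2 * ∑[ y < k ] ι y + + k
  ∑-shift² k = begin
    ∑[ y < k ] (+ suc (toℕ y) * + suc (toℕ y))
      ≡⟨ sum-cong-≗ {k} (λ y → trans (cong (λ z → z * z) (+suc (toℕ y))) (expand (ι y))) ⟩
    ∑[ y < k ] (ι y * ι y + + 2 * ι y + 1ℤ)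
      ≡⟨ ∑-distrib-+ {k} (λ y → ι y * ι y + + 2 * ι y) (λ _ → 1ℤ) ⟩
    ∑[ y < k ] (ι y * ι y + + 2 * ι y) + ∑[ y < k ] 1ℤ
      ≡⟨ cong₂ _+_ (trans (∑-distrib-+ {k} (λ y → ι y * ι y) (λ y → + 2 * ι y))
                          (cong (_+_ (∑[ y < k ] (ι y * ι y))) (∑-*ˡ k (+ 2) (ι {k}))))
                   (trans (∑-const k 1ℤ) (ℤ.*-identityʳ (+ k))) ⟩
    ∑[ y < k ] (ι y * ι y) + + 2 * ∑[ y < k ] ι y + + k ∎
    where
    open ≡-Reasoning
    expand : ∀ x → (1ℤ + x) * (1ℤ + x) ≡ x * x + + 2 * x + 1ℤ
    expand = solve-∀

  6∑ι²≡2k³-3k²+k : ∀ k → + 6 * ∑[ y < k ] (ι y * ι y) ≡ + 2 * (+ k * + k * + k) - + 3 * (+ k * + k) + + k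
  6∑ι²≡2k³-3k²+k zero    = refl
  6∑ι²≡2k³-3k²+k (suc k) = begin
    + 6 * (0ℤ + ∑[ y < k ] (+ suc (toℕ y) * + suc (toℕ y)))
      ≡⟨ cong (λ z → + 6 * (0ℤ + z)) (∑-shift² k) ⟩
    + 6 * (0ℤ + (∑[ y < k ] (ι y * ι y) + + 2 * ∑[ y < k ] ι y + + k))
      ≡⟨ step (∑[ y < k ] (ι y * ι y)) (∑[ y < k ] ι y) (+ k) ⟩
    + 6 * ∑[ y < k ] (ι y * ι y) + + 6 * (+ 2 * ∑[ y < k ] ι y) + + 6 * + k
      ≡⟨ cong₂ (λ u v → u + + 6 * v + + 6 * + k) (6∑ι²≡2k³-3k²+k k) (2∑ι≡k²-k k) ⟩
    + 2 * (+ k * + k * + k) - + 3 * (+ k * + k) + + k + + 6 * (+ k * + k - + k) + + 6 * + k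
      ≡⟨ cube (+ k) ⟩
    + 2 * ((1ℤ + + k) * (1ℤ + + k) * (1ℤ + + k)) - + 3 * ((1ℤ + + k) * (1ℤ + + k)) + (1ℤ + + k)
      ≡⟨ cong (λ z → + 2 * (z * z * z) - + 3 * (z * z) + z) (+suc k) ⟨
    + 2 * (+ suc k * + suc k * + suc k) - + 3 * (+ suc k * + suc k) + + suc k ∎
    where
    open ≡-Reasoning
    step : ∀ q t k → + 6 * (0ℤ + (q + + 2 * t + k)) ≡ + 6 * q + + 6 * (+ 2 * t) + + 6 * k
    step = solve-∀
    cube : ∀ k → + 2 * (k * k * k) - + 3 * (k * k) + k + + 6 * (k * k - k) + + 6 * k
               ≡ + 2 * ((1ℤ + k) * (1ℤ + k) * (1ℤ + k)) - + 3 * ((1ℤ + k) * (1ℤ + k)) + (1ℤ + k)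
    cube = solve-∀

  3∑∑dist≡k³-k : ∀ k → + 3 * ∑[ y < k ] ∑[ y′ < k ] dist (toℕ y) (toℕ y′) ≡ + k * + k * + k - + k
  3∑∑dist≡k³-k zero    = refl
  3∑∑dist≡k³-k (suc k) = begin
    + 3 * ((dist 0 0 + ∑[ y′ < k ] dist 0 (suc (toℕ y′)))
           + ∑[ y < k ] (dist (suc (toℕ y)) 0 + ∑[ y′ < k ] dist (suc (toℕ y)) (suc (toℕ y′))))
      ≡⟨ cong (λ z → + 3 * z) (cong₂ _+_ (cong (_+_ (dist 0 0)) first-row) (trans rows (cong₂ _+_ first-col inner))) ⟩
    + 3 * ((dist 0 0 + (∑[ y < k ] ι y + + k)) + ((∑[ y < k ] ι y + + k) + U))
      ≡⟨ step (∑[ y < k ] ι y) (+ k) U ⟩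
    + 3 * (+ 2 * ∑[ y < k ] ι y) + + 6 * + k + + 3 * U
      ≡⟨ cong₂ (λ u v → + 3 * u + + 6 * + k + v) (2∑ι≡k²-k k) (3∑∑dist≡k³-k k) ⟩
    + 3 * (+ k * + k - + k) + + 6 * + k + (+ k * + k * + k - + k)
      ≡⟨ cube (+ k) ⟩
    (1ℤ + + k) * (1ℤ + + k) * (1ℤ + + k) - (1ℤ + + k)
      ≡⟨ cong (λ z → z * z * z - z) (+suc k) ⟨
    + suc k * + suc k * + suc k - + suc k ∎
    where
    open ≡-Reasoning
    first-row : ∑[ y < k ] dist 0 (suc (toℕ y)) ≡ ∑[ y < k ] ι y + + k
    first-row = trans (sum-cong-≗ {k} (λ y → trans (dist-≤ z≤n) (ℤ.+-identityʳ (+ suc (toℕ y))))) (∑-shift k)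
    first-col : ∑[ y < k ] dist (suc (toℕ y)) 0 ≡ ∑[ y < k ] ι y + + k
    first-col = trans (sum-cong-≗ {k} (λ y → dist-sym (suc (toℕ y)) 0)) first-row
    U = ∑[ y < k ] ∑[ y′ < k ] dist (toℕ y) (toℕ y′)
    rows : ∑[ y < k ] (dist (suc (toℕ y)) 0 + ∑[ y′ < k ] dist (suc (toℕ y)) (suc (toℕ y′)))
           ≡ ∑[ y < k ] dist (suc (toℕ y)) 0 + ∑[ y < k ] ∑[ y′ < k ] dist (suc (toℕ y)) (suc (toℕ y′))
    rows = ∑-distrib-+ {k} (λ y → dist (suc (toℕ y)) 0) (λ y → ∑[ y′ < k ] dist (suc (toℕ y)) (suc (toℕ y′)))
    inner : ∑[ y < k ] ∑[ y′ < k ] dist (suc (toℕ y)) (suc (toℕ y′)) ≡ U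
    inner = sum-cong-≗ {k} (λ y → sum-cong-≗ {k} (λ y′ → dist-suc (toℕ y) (toℕ y′)))
    step : ∀ t k u → + 3 * ((0ℤ + (t + k)) + ((t + k) + u)) ≡ + 3 * (+ 2 * t) + + 6 * k + + 3 * u
    step = solve-∀
    cube : ∀ k → + 3 * (k * k - k) + + 6 * k + (k * k * k - k) ≡ (1ℤ + k) * (1ℤ + k) * (1ℤ + k) - (1ℤ + k)
    cube = solve-∀

  6∑∑sq≡k⁴-k² : ∀ k →
    + 6 * ∑[ y < k ] ∑[ y′ < k ] ((ι y - ι y′) * (ι y - ι y′)) ≡ + k * + k * (+ k * + k) - + k * + k
  6∑∑sq≡k⁴-k² k = begin
    + 6 * W                                    ≡⟨ cong (+ 6 *_) W≡2[MQ-F²] ⟩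
    + 6 * (+ 2 * (K * Q - F * F))              ≡⟨ regroup K Q F ⟩
    K * (+ 2 * (+ 6 * Q)) - + 3 * ((+ 2 * F) * (+ 2 * F))
      ≡⟨ cong₂ (λ q f → K * (+ 2 * q) - + 3 * (f * f)) (6∑ι²≡2k³-3k²+k k) (2∑ι≡k²-k k) ⟩
    K * (+ 2 * (+ 2 * (K * K * K) - + 3 * (K * K) + K)) - + 3 * ((K * K - K) * (K * K - K))
      ≡⟨ collect K ⟩
    K * K * (K * K) - K * K                    ∎
    where
    open ≡-Reasoning
    open Dispersion (toℕ {k}) using (W; W≡2[MQ-F²]; Q; F)
    K = + k
    regroup : ∀ k q f → + 6 * (+ 2 * (k * q - f * f)) ≡ k * (+ 2 * (+ 6 * q)) - + 3 * ((+ 2 * f) * (+ 2 * f))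
    regroup = solve-∀
    collect : ∀ k → k * (+ 2 * (+ 2 * (k * k * k) - + 3 * (k * k) + k)) - + 3 * ((k * k - k) * (k * k - k))
                    ≡ k * k * (k * k) - k * k
    collect = solve-∀

-- The circle is cut into k blocks; block y holds the a first-class vertices combine x y (in
-- part 2y) followed by the b second-class vertices combine x y (in part 2y + 1).
module Construction (a b k : ℕ) (0<a : 0 ℕ.< a) (0<b : 0 ℕ.< b) where

  open import Data.Nat as ℕ using (_+_; _*_)
  import Data.Nat.Properties as ℕ
  open import Data.Fin as Fin using (Fin; toℕ; zero; suc; combine; quotient; remainder; cast; _↑ˡ_; _↑ʳ_; fromℕ<)
  import Data.Fin.Properties as Fin
  open import Data.Product using (_×_; _,_; proj₂; ∃)
  open import Data.Sum using (_⊎_; inj₁; inj₂)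
  open import Data.Empty using (⊥-elim)
  open import Relation.Binary.PropositionalEquality using (refl; sym; trans; cong; cong₂; subst₂; module ≡-Reasoning)
  open import Relation.Nullary using (¬_)
  open CombineOrder

  V : Set
  V = Vertex (a * k) (b * k)

  block : V → Fin k
  block (inj₁ i) = remainder {a} k i
  block (inj₂ j) = remainder {b} k j

  offset : V → Fin (a + b)
  offset (inj₁ i) = quotient {a} k i ↑ˡ b
  offset (inj₂ j) = a ↑ʳ quotient {b} k j

  side : V → Fin 2
  side (inj₁ _) = zero
  side (inj₂ _) = suc zero

  private
    k*[a+b]≡a*k+b*k : k * (a + b) ≡ a * k + b * k
    k*[a+b]≡a*k+b*k = trans (ℕ.*-distribˡ-+ k a b) (cong₂ _+_ (ℕ.*-comm k a) (ℕ.*-comm k b))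

    k*2≡2*k : k * 2 ≡ 2 * k
    k*2≡2*k = ℕ.*-comm k 2

    cast-injective : ∀ {p q} .(e : p ≡ q) {x y : Fin p} → cast e x ≡ cast e y → x ≡ y
    cast-injective e {x} {y} cx≡cy =
      Fin.toℕ-injective (trans (sym (Fin.toℕ-cast e x)) (trans (cong toℕ cx≡cy) (Fin.toℕ-cast e y)))

    quotient-remainder-injective : ∀ {p} {i i′ : Fin (p * k)} →
      quotient {p} k i ≡ quotient {p} k i′ → remainder {p} k i ≡ remainder {p} k i′ → i ≡ i′
    quotient-remainder-injective {p} {i} {i′} q≡ r≡ =
      trans (sym (Fin.combine-remQuot {p} k i)) (trans (cong₂ combine q≡ r≡) (Fin.combine-remQuot {p} k i′))

  ↑ˡ<↑ʳ : ∀ (x : Fin a) (x′ : Fin b) → x ↑ˡ b Fin.< a ↑ʳ x′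
  ↑ˡ<↑ʳ x x′ =
    subst₂ ℕ._<_ (sym (Fin.toℕ-↑ˡ x b)) (sym (Fin.toℕ-↑ʳ a x′)) (ℕ.<-≤-trans (Fin.toℕ<n x) (ℕ.m≤m+n a (toℕ x′)))

  position : V → Fin (a * k + b * k)
  position v = cast k*[a+b]≡a*k+b*k (combine (block v) (offset v))

  partition : V → Fin (2 * k)
  partition v = cast k*2≡2*k (combine (block v) (side v))

  toℕ-position : ∀ v → toℕ (position v) ≡ toℕ (combine (block v) (offset v))
  toℕ-position v = Fin.toℕ-cast k*[a+b]≡a*k+b*k (combine (block v) (offset v))

  position-injective : ∀ {u v} → position u ≡ position v → u ≡ v
  position-injective {u} {v} pu≡pv
    with Fin.combine-injective (block u) (offset u) (block v) (offset v) (cast-injective k*[a+b]≡a*k+b*k pu≡pv)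
  position-injective {inj₁ i} {inj₁ i′} _ | b≡ , o≡ = cong inj₁ (quotient-remainder-injective (Fin.↑ˡ-injective b _ _ o≡) b≡)
  position-injective {inj₂ j} {inj₂ j′} _ | b≡ , o≡ = cong inj₂ (quotient-remainder-injective (Fin.↑ʳ-injective a _ _ o≡) b≡)
  position-injective {inj₁ i} {inj₂ j}  _ | _  , o≡ = ⊥-elim (ℕ.<-irrefl (cong toℕ o≡) (↑ˡ<↑ʳ _ _))
  position-injective {inj₂ j} {inj₁ i}  _ | _  , o≡ = ⊥-elim (ℕ.<-irrefl (cong toℕ (sym o≡)) (↑ˡ<↑ʳ _ _))

  sides-differ : ∀ i j → ¬ partition (inj₁ i) ≡ partition (inj₂ j)
  sides-differ i j p≡
    with Fin.combine-injectiveʳ (block (inj₁ i)) zero (block (inj₂ j)) (suc zero) (cast-injective k*2≡2*k p≡)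
  ... | ()

  partition-surjective : ∀ (p : Fin (2 * k)) → ∃ λ v → partition v ≡ p
  partition-surjective p with Fin.combine-surjective {k} {2} (cast (sym k*2≡2*k) p)
  ... | y , s , y,s≡p = representative s , Fin.toℕ-injective (begin
    toℕ (partition (representative s))                                   ≡⟨ Fin.toℕ-cast k*2≡2*k _ ⟩
    toℕ (combine (block (representative s)) (side (representative s)))   ≡⟨ cong toℕ (cong₂ combine (block-rep s) (side-rep s)) ⟩
    toℕ (combine y s)                                                    ≡⟨ cong toℕ y,s≡p ⟩
    toℕ (cast (sym k*2≡2*k) p)                                           ≡⟨ Fin.toℕ-cast (sym k*2≡2*k) p ⟩
    toℕ p                                                                ∎)
    where
    open ≡-Reasoning
    representative : Fin 2 → V
    representative zero       = inj₁ (combine (fromℕ< 0<a) y)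
    representative (suc zero) = inj₂ (combine (fromℕ< 0<b) y)
    block-rep : ∀ s → block (representative s) ≡ y
    block-rep zero       = cong proj₂ (Fin.remQuot-combine (fromℕ< 0<a) y)
    block-rep (suc zero) = cong proj₂ (Fin.remQuot-combine (fromℕ< 0<b) y)
    side-rep : ∀ s → side (representative s) ≡ s
    side-rep zero       = refl
    side-rep (suc zero) = refl

  partition-<⇒position-< : ∀ u v → partition u Fin.< partition v → position u Fin.< position v
  partition-<⇒position-< u v pu<pv =
    subst₂ ℕ._<_ (sym (toℕ-position u)) (sym (toℕ-position v))
      (lex-<-combine (sides⇒offsets u v (combine-<-lex
        (subst₂ ℕ._<_ (Fin.toℕ-cast k*2≡2*k _) (Fin.toℕ-cast k*2≡2*k _) pu<pv))))
    where
    sides⇒offsets : ∀ u v → block u Fin.< block v ⊎ (block u ≡ block v × side u Fin.< side v) →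
                    block u Fin.< block v ⊎ (block u ≡ block v × offset u Fin.< offset v)
    sides⇒offsets u        v        (inj₁ bu<bv)        = inj₁ bu<bv
    sides⇒offsets (inj₁ i) (inj₂ j) (inj₂ (bu≡bv , _)) = inj₂ (bu≡bv , ↑ˡ<↑ʳ _ _)
    sides⇒offsets (inj₁ i) (inj₁ _) (inj₂ (_ , ()))
    sides⇒offsets (inj₂ j) (inj₁ _) (inj₂ (_ , ()))
    sides⇒offsets (inj₂ j) (inj₂ _) (inj₂ (_ , ℕ.s≤s ()))

  drawing : Drawing (a * k) (b * k) (2 * k)
  drawing = record
    { part        = partition
    ; nonempty    = partition-surjective
    ; independent = sides-differ
    ; pos         = position
    ; pos-inj     = position-injective
    ; segments    = partition-<⇒position-<
    }

module ExtremalCount (a b k : ℕ) (0<a : 0 ℕ.< a) (0<b : 0 ℕ.< b) where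

  open import Data.Nat as ℕ using (_<_)
  import Data.Nat.Properties as ℕ
  open import Data.Nat.Properties using (_<?_)
  open import Data.Fin as Fin using (Fin; toℕ; combine; _↑ˡ_; _↑ʳ_)
  import Data.Fin.Properties as Fin
  open import Data.Integer as ℤ using (ℤ; +_; _+_; _*_; _-_; 1ℤ)
  import Data.Integer.Properties as ℤ
  open import Data.Integer.Tactic.RingSolver using (solve-∀)
  open import Data.Product using (_,_; proj₁; proj₂)
  open import Data.Sum using (inj₁; inj₂)
  open import Data.Empty using (⊥-elim)
  open import Relation.Binary.PropositionalEquality using (sym; trans; cong; cong₂; subst₂; module ≡-Reasoning)
  open Iverson
  open Summation
  open Comparisons
  open RangeSums
  open CombineOrder
  open Construction a b k 0<a 0<b using (drawing; toℕ-position; ↑ˡ<↑ʳ)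
  open CrossingIdentity drawing

  P-combine : ∀ (x : Fin a) (y : Fin k) → P (combine x y) ≡ toℕ (combine y (x ↑ˡ b))
  P-combine x y = trans (toℕ-position (inj₁ (combine x y))) (cong toℕ (cong₂ combine
    (cong proj₂ (Fin.remQuot-combine x y)) (cong (_↑ˡ b) (cong proj₁ (Fin.remQuot-combine x y)))))

  Q-combine : ∀ (x : Fin b) (y : Fin k) → Q (combine x y) ≡ toℕ (combine y (a ↑ʳ x))
  Q-combine x y = trans (toℕ-position (inj₂ (combine x y))) (cong toℕ (cong₂ combine
    (cong proj₂ (Fin.remQuot-combine x y)) (cong (a ↑ʳ_) (cong proj₁ (Fin.remQuot-combine x y)))))

  below-combine : ∀ (x : Fin a) (y : Fin k) (x′ : Fin b) (y′ : Fin k) →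
                  below (combine x y) (combine x′ y′) ≡ [ toℕ y′ <? toℕ y ]
  below-combine x y x′ y′ = bracket-⇔ (Q (combine x′ y′) <? P (combine x y)) (toℕ y′ <? toℕ y) earlier-block same-or-earlier
    where
    earlier-block : Q (combine x′ y′) < P (combine x y) → toℕ y′ < toℕ y
    earlier-block Q<P with combine-<-lex (subst₂ _<_ (Q-combine x′ y′) (P-combine x y) Q<P)
    ... | inj₁ y′<y             = y′<y
    ... | inj₂ (_ , a↑ʳx′<x↑ˡb) = ⊥-elim (ℕ.<-asym a↑ʳx′<x↑ˡb (↑ˡ<↑ʳ x x′))
    same-or-earlier : toℕ y′ < toℕ y → Q (combine x′ y′) < P (combine x y)
    same-or-earlier y′<y = subst₂ _<_ (sym (Q-combine x′ y′)) (sym (P-combine x y)) (lex-<-combine (inj₁ y′<y))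

  f-combine : ∀ (x : Fin a) (y : Fin k) → f (combine x y) ≡ b ℕ.* toℕ y
  f-combine x y = ℤ.+-injective (begin
    + f (combine x y)                                             ≡⟨ +f≡∑below (combine x y) ⟩
    ∑[ j < b ℕ.* k ] below (combine x y) j                        ≡⟨ ∑-combine b k (below (combine x y)) ⟩
    ∑[ x′ < b ] ∑[ y′ < k ] below (combine x y) (combine x′ y′)
      ≡⟨ sum-cong-≗ {b} (λ x′ → trans (sum-cong-≗ (below-combine x y x′)) (∑[<] k y)) ⟩
    ∑[ x′ < b ] ι y                                               ≡⟨ ∑-const b (ι y) ⟩
    + b * ι y                                                     ≡⟨ ℤ.pos-* b (toℕ y) ⟨
    + (b ℕ.* toℕ y)                                               ∎)
    where open ≡-Reasoning

  ∑∑∘f : ∀ (F : ℕ → ℕ → ℤ) → ∑[ i < a ℕ.* k ] ∑[ i′ < a ℕ.* k ] F (f i) (f i′)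
                                ≡ + a * (+ a * ∑[ y < k ] ∑[ y′ < k ] F (b ℕ.* toℕ y) (b ℕ.* toℕ y′))
  ∑∑∘f F = begin
    ∑[ i < a ℕ.* k ] ∑[ i′ < a ℕ.* k ] F (f i) (f i′)
      ≡⟨ ∑-combine a k (λ i → ∑[ i′ < a ℕ.* k ] F (f i) (f i′)) ⟩
    ∑[ x < a ] ∑[ y < k ] ∑[ i′ < a ℕ.* k ] F (f (combine x y)) (f i′)
      ≡⟨ sum-cong-≗ {a} (λ x → sum-cong-≗ {k} (row x)) ⟩
    ∑[ x < a ] ∑[ y < k ] (+ a * R y)
      ≡⟨ sum-cong-≗ {a} (λ _ → ∑-*ˡ k (+ a) R) ⟩
    ∑[ x < a ] (+ a * sum R)
      ≡⟨ ∑-const a (+ a * sum R) ⟩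
    + a * (+ a * sum R) ∎
    where
    open ≡-Reasoning
    R : Fin k → ℤ
    R y = ∑[ y′ < k ] F (b ℕ.* toℕ y) (b ℕ.* toℕ y′)
    row : ∀ x y → ∑[ i′ < a ℕ.* k ] F (f (combine x y)) (f i′) ≡ + a * R y
    row x y = trans (∑-combine a k (λ i′ → F (f (combine x y)) (f i′)))
                    (trans (sum-cong-≗ {a} (λ x′ → sum-cong-≗ {k} (λ y′ → cong₂ F (f-combine x y) (f-combine x′ y′))))
                           (∑-const a (R y)))

  open Dispersion f using (G; W)

  U V : ℤ
  U = ∑[ y < k ] ∑[ y′ < k ] dist (toℕ y) (toℕ y′)
  V = ∑[ y < k ] ∑[ y′ < k ] ((ι y - ι y′) * (ι y - ι y′))

  G≡a²bU : G ≡ + a * (+ a * (+ b * U))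
  G≡a²bU = trans (∑∑∘f dist) (cong (λ z → + a * (+ a * z))
    (trans (sum-cong-≗ {k} (λ y → trans (sum-cong-≗ {k} (λ y′ → dist-*ˡ b (toℕ y) (toℕ y′))) (∑-*ˡ k (+ b) (d y))))
           (∑-*ˡ k (+ b) (λ y → sum (d y)))))
    where
    d : Fin k → Fin k → ℤ
    d y y′ = dist (toℕ y) (toℕ y′)

  W≡a²b²V : W ≡ + a * (+ a * (+ b * + b * V))
  W≡a²b²V = trans (∑∑∘f (λ u v → (+ u - + v) * (+ u - + v))) (cong (λ z → + a * (+ a * z))
    (trans (sum-cong-≗ {k} (λ y → trans (sum-cong-≗ {k} (λ y′ → scale (toℕ y) (toℕ y′))) (∑-*ˡ k (+ b * + b) (sq y))))
           (∑-*ˡ k (+ b * + b) (λ y → sum (sq y)))))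
    where
    sq : Fin k → Fin k → ℤ
    sq y y′ = (ι y - ι y′) * (ι y - ι y′)
    factor : ∀ c u v → (c * u - c * v) * (c * u - c * v) ≡ c * c * ((u - v) * (u - v))
    factor = solve-∀
    scale : ∀ u v → (+ (b ℕ.* u) - + (b ℕ.* v)) * (+ (b ℕ.* u) - + (b ℕ.* v))
                    ≡ + b * + b * ((+ u - + v) * (+ u - + v))
    scale u v = trans (cong₂ (λ p q → (p - q) * (p - q)) (ℤ.pos-* b u) (ℤ.pos-* b v)) (factor (+ b) (+ u) (+ v))

  K : ℤ
  K = + k

  6K²Z≡[K²-1]M²N² : + 6 * (K * K) * Z ≡ (K * K - 1ℤ) * (M * M) * (N * N)
  6K²Z≡[K²-1]M²N² = begin
    + 6 * (K * K) * Z
      ≡⟨ cong (+ 6 * (K * K) *_) Z≡NG-W ⟩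
    + 6 * (K * K) * (N * G - W)
      ≡⟨ cong₂ (λ n z → + 6 * (K * K) * (n - z)) (cong₂ _*_ (ℤ.pos-* b k) G≡a²bU) W≡a²b²V ⟩
    + 6 * (K * K) * (+ b * K * (+ a * (+ a * (+ b * U))) - + a * (+ a * (+ b * + b * V)))
      ≡⟨ regroup K (+ a) (+ b) U V ⟩
    + a * + a * (+ b * + b) * (K * K) * (+ 2 * K * (+ 3 * U) - + 6 * V)
      ≡⟨ cong₂ (λ u v → + a * + a * (+ b * + b) * (K * K) * (+ 2 * K * u - v)) (3∑∑dist≡k³-k k) (6∑∑sq≡k⁴-k² k) ⟩
    + a * + a * (+ b * + b) * (K * K) * (+ 2 * K * (K * K * K - K) - (K * K * (K * K) - K * K))
      ≡⟨ collect K (+ a) (+ b) ⟩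
    (K * K - 1ℤ) * ((+ a * K) * (+ a * K)) * ((+ b * K) * (+ b * K))
      ≡⟨ cong₂ (λ p q → (K * K - 1ℤ) * (p * p) * (q * q)) (ℤ.pos-* a k) (ℤ.pos-* b k) ⟨
    (K * K - 1ℤ) * (M * M) * (N * N) ∎
    where
    open ≡-Reasoning
    regroup : ∀ k a b u v → + 6 * (k * k) * (b * k * (a * (a * (b * u))) - a * (a * (b * b * v)))
                            ≡ a * a * (b * b) * (k * k) * (+ 2 * k * (+ 3 * u) - + 6 * v)
    regroup = solve-∀
    collect : ∀ k a b → a * a * (b * b) * (k * k) * (+ 2 * k * (k * k * k - k) - (k * k * (k * k) - k * k))
                        ≡ (k * k - 1ℤ) * ((a * k) * (a * k)) * ((b * k) * (b * k))
    collect = solve-∀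

  exactℤ : + 3 * (K * K * (K * K)) * ((M * M - M) * (N * N - N))
           ≡ + 12 * (K * K * (K * K)) * + crossings drawing + K * K * ((K * K - 1ℤ) * (M * M) * (N * N))
  exactℤ = trans (scaled-crossing-identity K)
                 (cong (λ z → + 12 * (K * K * (K * K)) * + crossings drawing + K * K * z) 6K²Z≡[K²-1]M²N²)

module ToInteger where

  open import Data.Nat as ℕ using (zero; suc; z≤n; s≤s)
  import Data.Nat.Properties as ℕ
  open import Data.Nat.Combinatorics using (_C_; nCk+nC[k+1]≡[n+1]C[k+1]; nC1≡n)
  open import Data.Integer as ℤ using (ℤ; +_; _+_; _*_; _-_; _^_; 1ℤ)
  import Data.Integer.Properties as ℤ
  open import Data.Integer.Tactic.RingSolver using (solve-∀)
  open import Relation.Binary.PropositionalEquality using (refl; sym; trans; cong; cong₂; module ≡-Reasoning)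

  private
    pos-^ : ∀ a n → + (a ℕ.^ n) ≡ (+ a) ^ n
    pos-^ a zero    = refl
    pos-^ a (suc n) = trans (ℤ.pos-* a (a ℕ.^ n)) (cong (+ a *_) (pos-^ a n))

    pos-∸ : ∀ {x y} → y ℕ.≤ x → + (x ℕ.∸ y) ≡ + x - + y
    pos-∸ {x} {y} y≤x = trans (sym (ℤ.≤-⊖ y≤x)) (sym (ℤ.m-n≡m⊖n x y))

    -- Needed because the statement uses the truncated subtraction k ^ 4 ∸ k ^ 2.
    k²≤k⁴ : ∀ k → k ℕ.^ 2 ℕ.≤ k ℕ.^ 4
    k²≤k⁴ zero    = z≤n
    k²≤k⁴ (suc k) = ℕ.^-monoʳ-≤ (suc k) {2} {4} (s≤s (s≤s z≤n))

    2*[mC2]≡m²-m : ∀ m → + 2 * + (m C 2) ≡ + m * + m - + m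
    2*[mC2]≡m²-m zero    = refl
    2*[mC2]≡m²-m (suc m) = begin
      + 2 * + (suc m C 2)              ≡⟨ cong (λ c → + 2 * + c) (nCk+nC[k+1]≡[n+1]C[k+1] m 1) ⟨
      + 2 * + (m C 1 ℕ.+ m C 2)        ≡⟨ cong (+ 2 *_) (trans (ℤ.pos-+ (m C 1) (m C 2)) (cong (λ c → + c + + (m C 2)) (nC1≡n m))) ⟩
      + 2 * (+ m + + (m C 2))          ≡⟨ distrib (+ m) (+ (m C 2)) ⟩
      + 2 * + m + + 2 * + (m C 2)      ≡⟨ cong (_+_ (+ 2 * + m)) (2*[mC2]≡m²-m m) ⟩
      + 2 * + m + (+ m * + m - + m)    ≡⟨ square (+ m) ⟩
      (1ℤ + + m) * (1ℤ + + m) - (1ℤ + + m) ≡⟨ cong (λ z → z * z - z) (ℤ.pos-+ 1 m) ⟨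
      + suc m * + suc m - + suc m      ∎
      where
      open ≡-Reasoning
      distrib : ∀ a c → + 2 * (a + c) ≡ + 2 * a + + 2 * c
      distrib = solve-∀
      square : ∀ a → + 2 * a + (a * a - a) ≡ (1ℤ + a) * (1ℤ + a) - (1ℤ + a)
      square = solve-∀

  toℤ-lhs : ∀ k m n → + (12 ℕ.* k ℕ.^ 4 ℕ.* ((m C 2) ℕ.* (n C 2)))
                   ≡ + 3 * (+ k * + k * (+ k * + k)) * ((+ m * + m - + m) * (+ n * + n - + n))
  toℤ-lhs k m n = begin
    + (12 ℕ.* k ℕ.^ 4 ℕ.* ((m C 2) ℕ.* (n C 2)))
      ≡⟨ ℤ.pos-* (12 ℕ.* k ℕ.^ 4) _ ⟩
    + (12 ℕ.* k ℕ.^ 4) * + ((m C 2) ℕ.* (n C 2))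
      ≡⟨ cong₂ _*_ (trans (ℤ.pos-* 12 (k ℕ.^ 4)) (cong (+ 12 *_) (pos-^ k 4))) (ℤ.pos-* (m C 2) (n C 2)) ⟩
    + 12 * (+ k) ^ 4 * (+ (m C 2) * + (n C 2))
      ≡⟨ regroup (+ k) (+ (m C 2)) (+ (n C 2)) ⟩
    + 3 * (+ k * + k * (+ k * + k)) * ((+ 2 * + (m C 2)) * (+ 2 * + (n C 2)))
      ≡⟨ cong₂ (λ x y → + 3 * (+ k * + k * (+ k * + k)) * (x * y)) (2*[mC2]≡m²-m m) (2*[mC2]≡m²-m n) ⟩
    + 3 * (+ k * + k * (+ k * + k)) * ((+ m * + m - + m) * (+ n * + n - + n)) ∎
    where
    open ≡-Reasoning
    regroup : ∀ k a b → + 12 * (k * (k * (k * (k * 1ℤ)))) * (a * b) ≡ + 3 * (k * k * (k * k)) * ((+ 2 * a) * (+ 2 * b))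
    regroup = solve-∀

  toℤ-rhs : ∀ k m n c →
    + (12 ℕ.* k ℕ.^ 4 ℕ.* c ℕ.+ (k ℕ.^ 4 ℕ.∸ k ℕ.^ 2) ℕ.* (m ℕ.^ 2 ℕ.* n ℕ.^ 2))
      ≡ + 12 * (+ k * + k * (+ k * + k)) * + c + + k * + k * ((+ k * + k - 1ℤ) * (+ m * + m) * (+ n * + n))
  toℤ-rhs k m n c = begin
    + (12 ℕ.* k ℕ.^ 4 ℕ.* c ℕ.+ (k ℕ.^ 4 ℕ.∸ k ℕ.^ 2) ℕ.* (m ℕ.^ 2 ℕ.* n ℕ.^ 2))
      ≡⟨ ℤ.pos-+ (12 ℕ.* k ℕ.^ 4 ℕ.* c) _ ⟩
    + (12 ℕ.* k ℕ.^ 4 ℕ.* c) + + ((k ℕ.^ 4 ℕ.∸ k ℕ.^ 2) ℕ.* (m ℕ.^ 2 ℕ.* n ℕ.^ 2))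
      ≡⟨ cong₂ _+_ (trans (ℤ.pos-* (12 ℕ.* k ℕ.^ 4) c) (cong (_* + c) (trans (ℤ.pos-* 12 (k ℕ.^ 4)) (cong (+ 12 *_) (pos-^ k 4)))))
                   (trans (ℤ.pos-* (k ℕ.^ 4 ℕ.∸ k ℕ.^ 2) _)
                          (cong₂ _*_ (trans (pos-∸ (k²≤k⁴ k)) (cong₂ _-_ (pos-^ k 4) (pos-^ k 2)))
                                     (trans (ℤ.pos-* (m ℕ.^ 2) (n ℕ.^ 2)) (cong₂ _*_ (pos-^ m 2) (pos-^ n 2))))) ⟩
    + 12 * (+ k) ^ 4 * + c + ((+ k) ^ 4 - (+ k) ^ 2) * ((+ m) ^ 2 * (+ n) ^ 2)
      ≡⟨ normalise (+ k) (+ m) (+ n) (+ c) ⟩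
    + 12 * (+ k * + k * (+ k * + k)) * + c + + k * + k * ((+ k * + k - 1ℤ) * (+ m * + m) * (+ n * + n)) ∎
    where
    open ≡-Reasoning
    normalise : ∀ k m n c →
      + 12 * (k * (k * (k * (k * 1ℤ)))) * c + (k * (k * (k * (k * 1ℤ))) - k * (k * 1ℤ)) * (m * (m * 1ℤ) * (n * (n * 1ℤ)))
        ≡ + 12 * (k * k * (k * k)) * c + k * k * ((k * k - 1ℤ) * (m * m) * (n * n))
    normalise = solve-∀

open import Data.Nat using (ℕ; suc; _+_; _*_; _∸_; _^_; _≤_; _<_; s≤s; z≤n)
open import Data.Nat.Combinatorics using (_C_)
open import Data.Nat.Divisibility using (_∣_; divides)
open import Data.Product using (_×_; Σ; _,_)
open import Relation.Binary.PropositionalEquality using (refl; sym; trans; subst₂)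
import Data.Integer as ℤ
import Data.Integer.Properties as ℤ
open ToInteger using (toℤ-lhs; toℤ-rhs)

lower-bound : ∀ {m n k} (D : Drawing m n (2 * k)) → 0 < m →
  12 * k ^ 4 * ((m C 2) * (n C 2)) ≤ 12 * k ^ 4 * crossings D + (k ^ 4 ∸ k ^ 2) * (m ^ 2 * n ^ 2)
lower-bound {m} {n} {k} D 0<m = ℤ.drop‿+≤+
  (subst₂ ℤ._≤_ (sym (toℤ-lhs k m n)) (sym (toℤ-rhs k m n (crossings D))) (LowerBound.lower-boundℤ {m} {n} {k} D 0<m))

extremal-drawing : ∀ {m n k} → 0 < m → 0 < n → k ∣ m → k ∣ n → Σ (Drawing m n (2 * k)) λ D →
  12 * k ^ 4 * crossings D + (k ^ 4 ∸ k ^ 2) * (m ^ 2 * n ^ 2) ≡ 12 * k ^ 4 * ((m C 2) * (n C 2))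
extremal-drawing {k = k} 0<m 0<n (divides a refl) (divides b refl) =
  drawing , ℤ.+-injective (trans (toℤ-rhs k (a * k) (b * k) (crossings drawing))
                                 (trans (sym (ExtremalCount.exactℤ a b k 0<a 0<b)) (sym (toℤ-lhs k (a * k) (b * k)))))
  where
  0<factor : ∀ a {k} → 0 < a * k → 0 < a
  0<factor (suc a) _ = s≤s z≤n
  0<a = 0<factor a 0<m
  0<b = 0<factor b 0<n
  drawing = Construction.drawing a b k 0<a 0<b

theorem2 : (m n k : ℕ) → 0 < m → 0 < n → 0 < k → 2 * k ≤ m + n →
    ((D : Drawing m n (2 * k)) →
       12 * k ^ 4 * ((m C 2) * (n C 2)) ≤ 12 * k ^ 4 * crossings D + (k ^ 4 ∸ k ^ 2) * (m ^ 2 * n ^ 2))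
    × (k ∣ m → k ∣ n →
       Σ (Drawing m n (2 * k)) λ D →
         12 * k ^ 4 * crossings D + (k ^ 4 ∸ k ^ 2) * (m ^ 2 * n ^ 2) ≡ 12 * k ^ 4 * ((m C 2) * (n C 2)))
theorem2 m n k 0<m 0<n _ _ = (λ D → lower-bound {k = k} D 0<m) , extremal-drawing 0<m 0<n
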